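{- For every connected graph $G$ of order $n$, $$\sigma_t(G)\le \sqrt{1.5}\, n^{5/2}\,\sigma(G).$$ Moreover, this is sharp up to a constant factor: there exist a constant $c>0$ and an integer $N$ such that for every $n\ge N$ there is a connected graph $G$ of order $n$ with $\sigma(G)>0$ and $\sigma_t(G)\ge c\, n^{5/2}\,\sigma(G)$. Equivalently, the maximum of $\sigma_t(G)/\sigma(G)$ over connected irregular graphs $G$ of order $n$ is $\Theta(n^{5/2})$.
   Context: For a graph $G=(V,E)$, $d(u)$ denotes the degree of a vertex $u$. Define $\sigma(G)=\sum_{uv\in E(G)}(d(u)-d(v))^2$ (sum over edges) and $\sigma_t(G)=\sum_{\{u,v\}\subseteq V(G)}(d(u)-d(v))^2$ (sum over all unordered pairs of distinct vertices). A graph is irregular if not all its vertices have the same degree. -}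

module Defs where

open import Data.Nat using (ℕ; _+_; _*_; _^_; ∣_-_∣)
open import Data.Bool using (Bool; true; false; if_then_else_; T; _∧_)
open import Data.Fin using (Fin; _<?_)
open import Data.List using (map; allFin)
open import Data.Nat.ListAction using (sum)
open import Relation.Nullary.Decidable using (⌊_⌋)
open import Relation.Binary.PropositionalEquality using (_≡_)

record SimpleGraph (n : ℕ) : Set where
  field
    adj    : Fin n → Fin n → Bool
    sym    : ∀ u v → adj u v ≡ adj v u
    irrefl : ∀ u → adj u u ≡ false
open SimpleGraph public

Σv : {n : ℕ} → (Fin n → ℕ) → ℕ
Σv {n} f = sum (map f (allFin n))

degree : {n : ℕ} → SimpleGraph n → Fin n → ℕ
degree G u = Σv (λ v → if adj G u v then 1 else 0)

data Reachable {n : ℕ} (G : SimpleGraph n) : Fin n → Fin n → Set where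
  here : ∀ {u} → Reachable G u u
  step : ∀ {u v w} → T (adj G u v) → Reachable G v w → Reachable G u w

Connected : {n : ℕ} → SimpleGraph n → Set
Connected {n} G = ∀ (u v : Fin n) → Reachable G u v

sqDiff : {n : ℕ} → SimpleGraph n → Fin n → Fin n → ℕ
sqDiff G u v = ∣ degree G u - degree G v ∣ ^ 2

-- σ(G): sum over edges uv (each unordered edge once, via u < v)
σ : {n : ℕ} → SimpleGraph n → ℕ
σ G = Σv (λ u → Σv (λ v → if ⌊ u <? v ⌋ ∧ adj G u v then sqDiff G u v else 0))

-- σ_t(G): sum over all unordered pairs of distinct vertices (u < v)
σt : {n : ℕ} → SimpleGraph n → ℕ
σt G = Σv (λ u → Σv (λ v → if ⌊ u <? v ⌋ then sqDiff G u v else 0))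

-- Let δ ≤ Δ be the extreme degrees and D = Δ − δ. The degrees shifted by δ lie in [0, D], so
-- the variance identity gives 4σt ≤ (nD)². Tighten a walk from a vertex of degree Δ to one of degree δ into
-- a path without shortcuts, as a shortest path would be: it uses every edge at most once, so its cost
-- ∑ (d(u) − d(v))² over its edges is at most σ, and every vertex has at most three neighbours on it, so the
-- degrees along it sum to at most 3n. Hence D ≤ σ; and for a threshold t, the j vertices preceding the first
-- one of degree ≤ t have degrees > t, so j(t + 1) ≤ 3n, while Cauchy–Schwarz gives (Δ − t)² ≤ jσ. With
-- t = δ + ⌊D/2⌋ this is D³ ≤ 24nσ, and 16 · 2σt² ≤ 2(nD)⁴ ≤ 2n⁴ · σ · 24nσ.
--
-- In a level graph two distinct vertices are adjacent iff their levels differ by at most one.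
-- Take blocks of levels of sizes (1 + s j, 1, 1), with s rising from 0 to 3K/2 and back to 0, followed by
-- at least 16K² singleton levels. Each block boundary contributes a single edge of weight at most 1, so
-- σ = O(K), while about K² vertices of degree at least K face the 16K² tail vertices of degree at most 2,
-- so σt = Ω(K⁶). Choosing K with 64K² ≤ n < 64(K + 1)² gives σt ≥ c n^{5/2} σ.

module Submission where

open import Defs hiding (sym)
open import Data.Bool using (Bool; true; false; if_then_else_; T; not; _∧_)
open import Data.Bool.Properties using (T?; T-∧; ∧-comm; ∧-identityʳ; ∧-zeroʳ)
open import Data.Empty using (⊥-elim)
open import Data.Fin using (Fin; zero; suc; toℕ; _≟_; _<?_)
import Data.Fin.Properties as Fin
open import Data.List using (List; []; _∷_; _++_; map; allFin; tabulate; length; lookup; replicate)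
open import Data.List.Membership.Propositional using (_∈_; _∉_)
open import Data.List.Membership.Propositional.Properties using (∈-allFin)
open import Data.List.Properties
  using (map-tabulate; map-cong; map-++; map-∘; map-replicate; length-++; length-map; length-replicate)
open import Data.List.Relation.Unary.All as All using (All; []; _∷_)
open import Data.List.Relation.Unary.All.Properties.Core using (¬Any⇒All¬)
open import Data.List.Relation.Unary.Any as Any using (Any; here; there)
open import Data.Nat
  using (ℕ; zero; suc; _+_; _*_; _^_; _∸_; ∣_-_∣; _≤_; _<_; z≤n; s≤s; z<s; _≤?_; _≡ᵇ_; _≤ᵇ_; _<ᵇ_; _⊓_; >-nonZero; ⌊_/2⌋; ⌈_/2⌉)
open import Data.Nat.Properties hiding (_≟_; _<?_; _≤?_)
import Data.Nat.ListAction as List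
import Data.Nat.ListAction.Properties as List
open import Data.List.Extrema ≤-totalOrder using (argmax; argmin; f[xs]≤f[argmax]; f[argmin]≤f[xs])
open import Data.Nat.Solver using (module +-*-Solver)
open import Data.Product using (Σ; Σ-syntax; ∃-syntax; _×_; _,_; proj₁; proj₂)
open import Data.Unit using (⊤; tt)
open import Function using (_∘_; id; Equivalence)
open import Relation.Nullary using (¬_; Dec; yes; no)
open import Relation.Nullary.Decidable using (⌊_⌋; _×-dec_; dec-false; isYes≗does; ⌊⌋-map′)
open import Relation.Binary.Definitions using (tri<; tri≈; tri>)
open import Relation.Binary.PropositionalEquality
open import Algebra.Properties.Semiring.Sum +-*-semiring
  using (sum; sum-syntax; sum-cong-≗; ∑-distrib-+; ∑-comm; *-distribˡ-sum; *-distribʳ-sum)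

open +-*-Solver using (solve; _:+_; _:*_; _:^_; _:=_; con)

⟦_⟧ : Bool → ℕ
⟦ b ⟧ = if b then 1 else 0

⟦⟧≤1 : ∀ b → ⟦ b ⟧ ≤ 1
⟦⟧≤1 true  = ≤-refl
⟦⟧≤1 false = z≤n

⌊⌋≡false : ∀ {A : Set} (a? : Dec A) → ¬ A → ⌊ a? ⌋ ≡ false
⌊⌋≡false a? ¬a = trans (isYes≗does a?) (dec-false a? ¬a)

Σv≡∑ : ∀ {n} (f : Fin n → ℕ) → Σv f ≡ ∑[ i < n ] f i
Σv≡∑ {zero}  f = refl
Σv≡∑ {suc n} f = cong (f zero +_) (begin
  List.sum (map f (tabulate suc))
    ≡⟨ cong List.sum (map-tabulate suc f) ⟩
  List.sum (tabulate (f ∘ suc))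
    ≡⟨ cong List.sum (map-tabulate id (f ∘ suc)) ⟨
  Σv (f ∘ suc)
    ≡⟨ Σv≡∑ (f ∘ suc) ⟩
  ∑[ i < n ] f (suc i) ∎)
  where open ≡-Reasoning

Σv²≡∑² : ∀ {n} (f : Fin n → Fin n → ℕ) → Σv (λ u → Σv (f u)) ≡ ∑[ u < n ] ∑[ v < n ] f u v
Σv²≡∑² f = trans (Σv≡∑ (λ u → Σv (f u))) (sum-cong-≗ (Σv≡∑ ∘ f))

∑-mono : ∀ {n} {f g : Fin n → ℕ} → (∀ i → f i ≤ g i) → ∑[ i < n ] f i ≤ ∑[ i < n ] g i
∑-mono {zero}  _   = z≤n
∑-mono {suc n} f≤g = +-mono-≤ (f≤g zero) (∑-mono (f≤g ∘ suc))

∑-const : ∀ n c → ∑[ i < n ] c ≡ n * c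
∑-const zero    c = refl
∑-const (suc n) c = cong (c +_) (∑-const n c)

∑-zero : ∀ n → ∑[ i < n ] 0 ≡ 0
∑-zero n = trans (∑-const n 0) (*-zeroʳ n)

f≤∑f : ∀ {n} (f : Fin n → ℕ) i → f i ≤ ∑[ j < n ] f j
f≤∑f f zero    = m≤m+n _ _
f≤∑f f (suc i) = ≤-trans (f≤∑f (f ∘ suc) i) (m≤n+m _ _)

∑-pick : ∀ {n} (g : Fin n → ℕ) b → ∑[ v < n ] (⟦ ⌊ v ≟ b ⌋ ⟧ * g v) ≡ g b
∑-pick {suc n} g zero =
  trans (cong₂ _+_ (+-identityʳ (g zero)) (∑-zero n)) (+-identityʳ (g zero))
∑-pick {suc n} g (suc b) =
  trans (sum-cong-≗ (λ v → cong (λ x → ⟦ x ⟧ * g (suc v)) (⌊⌋-map′ _ _ (v ≟ b)))) (∑-pick (g ∘ suc) b)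

∑²-pick : ∀ {n} (g : Fin n → Fin n → ℕ) a c →
          ∑[ u < n ] ∑[ v < n ] (⟦ ⌊ u ≟ a ⌋ ∧ ⌊ v ≟ c ⌋ ⟧ * g u v) ≡ g a c
∑²-pick {n} g a c = trans (sum-cong-≗ row) (∑-pick (λ u → g u c) a)
  where
  row : ∀ u → ∑[ v < n ] (⟦ ⌊ u ≟ a ⌋ ∧ ⌊ v ≟ c ⌋ ⟧ * g u v) ≡ ⟦ ⌊ u ≟ a ⌋ ⟧ * g u c
  row u with ⌊ u ≟ a ⌋
  ... | true  = trans (∑-pick (g u) c) (sym (+-identityʳ (g u c)))
  ... | false = ∑-zero n

∑-positive : ∀ {n} (f : Fin n → ℕ) → 0 < ∑[ i < n ] f i → ∃[ i ] 0 < f i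
∑-positive {suc n} f pos with f zero in eq
... | suc _ = zero , subst (0 <_) (sym eq) z<s
... | zero  = let i , fi>0 = ∑-positive (f ∘ suc) pos in suc i , fi>0

sum-map-∑ : ∀ {n} {A : Set} (g : A → Fin n → ℕ) (xs : List A) →
            List.sum (map (λ x → ∑[ w < n ] g x w) xs) ≡ ∑[ w < n ] List.sum (map (λ x → g x w) xs)
sum-map-∑ {n} g []       = sym (∑-zero n)
sum-map-∑     g (x ∷ xs) =
  trans (cong (sum (g x) +_) (sum-map-∑ g xs)) (sym (∑-distrib-+ (g x) _))

∑²-symmetric : ∀ {n} (g : Fin n → Fin n → ℕ) → (∀ u v → g u v ≡ g v u) → (∀ u → g u u ≡ 0) →
               ∑[ u < n ] ∑[ v < n ] g u v ≡ 2 * ∑[ u < n ] ∑[ v < n ] (if ⌊ u <? v ⌋ then g u v else 0)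
∑²-symmetric {n} g g-sym g-diag = begin
  ∑[ u < n ] ∑[ v < n ] g u v
    ≡⟨ sum-cong-≗ (λ u → sum-cong-≗ (split u)) ⟩
  ∑[ u < n ] ∑[ v < n ] (lower u v + lower v u)
    ≡⟨ sum-cong-≗ (λ u → ∑-distrib-+ (lower u) (λ v → lower v u)) ⟩
  ∑[ u < n ] (∑[ v < n ] lower u v + ∑[ v < n ] lower v u)
    ≡⟨ ∑-distrib-+ (λ u → ∑[ v < n ] lower u v) (λ u → ∑[ v < n ] lower v u) ⟩
  L + ∑[ u < n ] ∑[ v < n ] lower v u
    ≡⟨ cong (L +_) (∑-comm (λ u v → lower v u)) ⟩
  L + L
    ≡⟨ cong (L +_) (+-identityʳ L) ⟨
  2 * L ∎
  where
  open ≡-Reasoning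
  lower : Fin n → Fin n → ℕ
  lower u v = if ⌊ u <? v ⌋ then g u v else 0
  L : ℕ
  L = ∑[ u < n ] ∑[ v < n ] lower u v
  split : ∀ u v → g u v ≡ lower u v + lower v u
  split u v with u <? v | v <? u
  ... | yes u<v | yes v<u = ⊥-elim (Fin.<-asym u<v v<u)
  ... | yes _   | no _    = sym (+-identityʳ (g u v))
  ... | no _    | yes _   = g-sym u v
  ... | no u≮v  | no v≮u with Fin.<-cmp u v
  ...   | tri< u<v _ _    = ⊥-elim (u≮v u<v)
  ...   | tri≈ _ refl _   = g-diag u
  ...   | tri> _ _ v<u    = ⊥-elim (v≮u v<u)

∑²-distrib-+ : ∀ {n} (f g : Fin n → Fin n → ℕ) →
               ∑[ u < n ] ∑[ v < n ] (f u v + g u v) ≡ ∑[ u < n ] ∑[ v < n ] f u v + ∑[ u < n ] ∑[ v < n ] g u v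
∑²-distrib-+ f g = trans (sum-cong-≗ (λ u → ∑-distrib-+ (f u) (g u))) (∑-distrib-+ (λ u → sum (f u)) (λ u → sum (g u)))

m≤m² : ∀ m → m ≤ m ^ 2
m≤m² zero    = z≤n
m≤m² (suc m) = m≤m*n (suc m) (suc m * 1)

∣m-n∣²+2mn≡m²+n² : ∀ m n → ∣ m - n ∣ ^ 2 + 2 * (m * n) ≡ m ^ 2 + n ^ 2
∣m-n∣²+2mn≡m²+n² zero    n       = solve 1 (λ n → n :^ 2 :+ con 2 :* (con 0 :* n) := con 0 :^ 2 :+ n :^ 2) refl n
∣m-n∣²+2mn≡m²+n² (suc m) zero    = solve 1 (λ m → m :^ 2 :+ con 2 :* (m :* con 0) := m :^ 2 :+ con 0 :^ 2) refl (suc m)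
∣m-n∣²+2mn≡m²+n² (suc m) (suc n) = begin
  ∣ m - n ∣ ^ 2 + 2 * (suc m * suc n)
    ≡⟨ solve 3 (λ x m n → x :+ con 2 :* ((con 1 :+ m) :* (con 1 :+ n))
        := x :+ con 2 :* (m :* n) :+ con 2 :* (m :+ n :+ con 1)) refl (∣ m - n ∣ ^ 2) m n ⟩
  ∣ m - n ∣ ^ 2 + 2 * (m * n) + 2 * (m + n + 1)
    ≡⟨ cong (_+ 2 * (m + n + 1)) (∣m-n∣²+2mn≡m²+n² m n) ⟩
  m ^ 2 + n ^ 2 + 2 * (m + n + 1)
    ≡⟨ solve 2 (λ m n → m :^ 2 :+ n :^ 2 :+ con 2 :* (m :+ n :+ con 1)
        := (con 1 :+ m) :^ 2 :+ (con 1 :+ n) :^ 2) refl m n ⟩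
  suc m ^ 2 + suc n ^ 2 ∎
  where open ≡-Reasoning

2mn≤m²+n² : ∀ m n → 2 * (m * n) ≤ m ^ 2 + n ^ 2
2mn≤m²+n² m n = subst (2 * (m * n) ≤_) (∣m-n∣²+2mn≡m²+n² m n) (m≤n+m (2 * (m * n)) (∣ m - n ∣ ^ 2))

module _ {n : ℕ} (y : Fin n → ℕ) where
  private
    S₁ S₂ V : ℕ
    S₁ = ∑[ u < n ] y u
    S₂ = ∑[ u < n ] (y u ^ 2)
    V  = ∑[ u < n ] ∑[ v < n ] (∣ y u - y v ∣ ^ 2)

  ∑²[y-y]²+2[∑y]²≡2n∑y² : V + 2 * (S₁ * S₁) ≡ 2 * (n * S₂)
  ∑²[y-y]²+2[∑y]²≡2n∑y² = begin
    V + 2 * (S₁ * S₁)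
      ≡⟨ cong (V +_) cross ⟨
    V + ∑[ u < n ] ∑[ v < n ] (2 * (y u * y v))
      ≡⟨ ∑²-distrib-+ (λ u v → ∣ y u - y v ∣ ^ 2) (λ u v → 2 * (y u * y v)) ⟨
    ∑[ u < n ] ∑[ v < n ] (∣ y u - y v ∣ ^ 2 + 2 * (y u * y v))
      ≡⟨ sum-cong-≗ (λ u → sum-cong-≗ (λ v → ∣m-n∣²+2mn≡m²+n² (y u) (y v))) ⟩
    ∑[ u < n ] ∑[ v < n ] (y u ^ 2 + y v ^ 2)
      ≡⟨ ∑²-distrib-+ (λ u _ → y u ^ 2) (λ _ v → y v ^ 2) ⟩
    ∑[ u < n ] ∑[ v < n ] (y u ^ 2) + ∑[ u < n ] S₂
      ≡⟨ cong₂ _+_ (sum-cong-≗ (λ u → ∑-const n (y u ^ 2))) (∑-const n S₂) ⟩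
    ∑[ u < n ] (n * y u ^ 2) + n * S₂
      ≡⟨ cong (_+ n * S₂) (*-distribˡ-sum n (λ u → y u ^ 2)) ⟨
    n * S₂ + n * S₂
      ≡⟨ cong (n * S₂ +_) (+-identityʳ (n * S₂)) ⟨
    2 * (n * S₂) ∎
    where
    open ≡-Reasoning
    cross : ∑[ u < n ] ∑[ v < n ] (2 * (y u * y v)) ≡ 2 * (S₁ * S₁)
    cross = begin
      ∑[ u < n ] ∑[ v < n ] (2 * (y u * y v))
        ≡⟨ sum-cong-≗ (λ u → sum-cong-≗ (λ v → *-assoc 2 (y u) (y v))) ⟨
      ∑[ u < n ] ∑[ v < n ] (2 * y u * y v)
        ≡⟨ sum-cong-≗ (λ u → *-distribˡ-sum (2 * y u) y) ⟨
      ∑[ u < n ] (2 * y u * S₁)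
        ≡⟨ sum-cong-≗ (λ u → *-comm (2 * y u) S₁) ⟩
      ∑[ u < n ] (S₁ * (2 * y u))
        ≡⟨ *-distribˡ-sum S₁ (λ u → 2 * y u) ⟨
      S₁ * ∑[ u < n ] (2 * y u)
        ≡⟨ cong (S₁ *_) (*-distribˡ-sum 2 y) ⟨
      S₁ * (2 * S₁)
        ≡⟨ solve 1 (λ s → s :* (con 2 :* s) := con 2 :* (s :* s)) refl S₁ ⟩
      2 * (S₁ * S₁) ∎

  variance-bound : ∀ D → (∀ u → y u ≤ D) → 2 * V ≤ (n * D) ^ 2
  variance-bound D y≤D = +-cancelʳ-≤ (4 * (S₁ * S₁)) (2 * V) ((n * D) ^ 2) (begin
    2 * V + 4 * (S₁ * S₁)
      ≡⟨ solve 2 (λ v s → con 2 :* v :+ con 4 :* (s :* s) := con 2 :* (v :+ con 2 :* (s :* s))) refl V S₁ ⟩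
    2 * (V + 2 * (S₁ * S₁))
      ≡⟨ cong (2 *_) ∑²[y-y]²+2[∑y]²≡2n∑y² ⟩
    2 * (2 * (n * S₂))
      ≤⟨ *-monoʳ-≤ 2 (*-monoʳ-≤ 2 (*-monoʳ-≤ n S₂≤DS₁)) ⟩
    2 * (2 * (n * (D * S₁)))
      ≡⟨ solve 3 (λ n d s → con 2 :* (con 2 :* (n :* (d :* s))) := con 2 :* ((n :* d) :* (con 2 :* s))) refl n D S₁ ⟩
    2 * ((n * D) * (2 * S₁))
      ≤⟨ 2mn≤m²+n² (n * D) (2 * S₁) ⟩
    (n * D) ^ 2 + (2 * S₁) ^ 2
      ≡⟨ cong ((n * D) ^ 2 +_) (solve 1 (λ s → (con 2 :* s) :^ 2 := con 4 :* (s :* s)) refl S₁) ⟩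
    (n * D) ^ 2 + 4 * (S₁ * S₁) ∎)
    where
    open ≤-Reasoning
    S₂≤DS₁ : S₂ ≤ D * S₁
    S₂≤DS₁ = ≤-trans (∑-mono (λ u → ≤-trans (*-monoʳ-≤ (y u) (≤-trans (≤-reflexive (*-identityʳ (y u))) (y≤D u)))
                                            (≤-reflexive (*-comm (y u) D))))
                     (≤-reflexive (sym (*-distribˡ-sum D y)))

[x+y]²≤[1+j][x²+E] : ∀ j x y E → 1 ≤ j → y ^ 2 ≤ j * E → (x + y) ^ 2 ≤ suc j * (x ^ 2 + E)
[x+y]²≤[1+j][x²+E] j@(suc _) x y E _ y²≤jE = *-cancelˡ-≤ j (begin
  j * (x + y) ^ 2
    ≡⟨ solve 3 (λ j x y → j :* (x :+ y) :^ 2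
        := j :* x :^ 2 :+ con 2 :* ((j :* x) :* y) :+ j :* y :^ 2) refl j x y ⟩
  j * x ^ 2 + 2 * ((j * x) * y) + j * y ^ 2
    ≤⟨ +-monoˡ-≤ (j * y ^ 2) (+-monoʳ-≤ (j * x ^ 2) (2mn≤m²+n² (j * x) y)) ⟩
  j * x ^ 2 + ((j * x) ^ 2 + y ^ 2) + j * y ^ 2
    ≡⟨ solve 3 (λ j x y → j :* x :^ 2 :+ ((j :* x) :^ 2 :+ y :^ 2) :+ j :* y :^ 2
        := j :* ((con 1 :+ j) :* x :^ 2) :+ (con 1 :+ j) :* y :^ 2) refl j x y ⟩
  j * (suc j * x ^ 2) + suc j * y ^ 2
    ≤⟨ +-monoʳ-≤ (j * (suc j * x ^ 2)) (*-monoʳ-≤ (suc j) y²≤jE) ⟩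
  j * (suc j * x ^ 2) + suc j * (j * E)
    ≡⟨ solve 3 (λ j x e → j :* ((con 1 :+ j) :* x :^ 2) :+ (con 1 :+ j) :* (j :* e)
        := j :* ((con 1 :+ j) :* (x :^ 2 :+ e))) refl j x E ⟩
  j * (suc j * (x ^ 2 + E)) ∎)
  where open ≤-Reasoning

if-∧ : ∀ b c (x : ℕ) → (if b ∧ c then x else 0) ≡ (if b then (if c then x else 0) else 0)
if-∧ true  c x = refl
if-∧ false c x = refl

¬T⇒⟦⟧≡0 : ∀ {b} → ¬ T b → ⟦ b ⟧ ≡ 0
¬T⇒⟦⟧≡0 {false} _  = refl
¬T⇒⟦⟧≡0 {true}  ¬t = ⊥-elim (¬t tt)

module _ {n : ℕ} (G : SimpleGraph n) where

  adj-sym : ∀ {u v} → T (adj G u v) → T (adj G v u)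
  adj-sym {u} {v} = subst T (SimpleGraph.sym G u v)

  sqDiff-sym : ∀ u v → sqDiff G u v ≡ sqDiff G v u
  sqDiff-sym u v = cong (_^ 2) (∣-∣-comm (degree G u) (degree G v))

  sqDiff-diag : ∀ u → sqDiff G u u ≡ 0
  sqDiff-diag u = cong (_^ 2) (∣n-n∣≡0 (degree G u))

  edgeWeight : Fin n → Fin n → ℕ
  edgeWeight u v = if adj G u v then sqDiff G u v else 0

  edgeWeight-edge : ∀ {u v} → T (adj G u v) → edgeWeight u v ≡ sqDiff G u v
  edgeWeight-edge {u} {v} e with adj G u v
  ... | true = refl

  edgeWeight-sym : ∀ u v → edgeWeight u v ≡ edgeWeight v u
  edgeWeight-sym u v rewrite SimpleGraph.sym G u v | sqDiff-sym u v = refl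

  edgeWeight-diag : ∀ u → edgeWeight u u ≡ 0
  edgeWeight-diag u rewrite SimpleGraph.irrefl G u = refl

  2σt≡∑²sqDiff : 2 * σt G ≡ ∑[ u < n ] ∑[ v < n ] sqDiff G u v
  2σt≡∑²sqDiff = trans (cong (2 *_) (Σv²≡∑² (λ u v → if ⌊ u <? v ⌋ then sqDiff G u v else 0)))
                       (sym (∑²-symmetric (sqDiff G) sqDiff-sym sqDiff-diag))

  2σ≡∑²edgeWeight : 2 * σ G ≡ ∑[ u < n ] ∑[ v < n ] edgeWeight u v
  2σ≡∑²edgeWeight = begin
    2 * σ G
      ≡⟨ cong (2 *_) (Σv²≡∑² (λ u v → if ⌊ u <? v ⌋ ∧ adj G u v then sqDiff G u v else 0)) ⟩
    2 * ∑[ u < n ] ∑[ v < n ] (if ⌊ u <? v ⌋ ∧ adj G u v then sqDiff G u v else 0)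
      ≡⟨ cong (2 *_) (sum-cong-≗ (λ u → sum-cong-≗ (λ v → if-∧ ⌊ u <? v ⌋ (adj G u v) (sqDiff G u v)))) ⟩
    2 * ∑[ u < n ] ∑[ v < n ] (if ⌊ u <? v ⌋ then edgeWeight u v else 0)
      ≡⟨ ∑²-symmetric edgeWeight edgeWeight-sym edgeWeight-diag ⟨
    ∑[ u < n ] ∑[ v < n ] edgeWeight u v ∎
    where open ≡-Reasoning

  private
    variable
      a b c : Fin n

  len : Reachable G a b → ℕ
  len here       = 0
  len (step _ p) = suc (len p)

  vertices : Reachable G a b → List (Fin n)
  vertices (here {a})     = a ∷ []
  vertices (step {a} _ p) = a ∷ vertices p

  start∈vertices : (p : Reachable G a b) → a ∈ vertices p
  start∈vertices here       = here refl
  start∈vertices (step _ p) = here refl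

  later : Reachable G a b → List (Fin n)
  later here                = []
  later (step _ here)       = []
  later (step _ (step _ p)) = vertices p

  Distinct : Reachable G a b → Set
  Distinct here           = ⊤
  Distinct (step {a} _ p) = a ∉ vertices p × Distinct p

  -- As on a shortest path, no vertex is adjacent both to a vertex of the walk and to one three or more
  -- steps further on; hence every vertex has at most three neighbours on a shortcut-free walk.
  ShortcutFree : Reachable G a b → Set
  ShortcutFree here           = ⊤
  ShortcutFree (step {a} _ p) = (∀ w → T (adj G a w) → All (λ x → ¬ T (adj G x w)) (later p)) × ShortcutFree p

  suffix : ∀ {P : Fin n → Set} (p : Reachable G a b) → Any P (vertices p) →
           ∃[ x ] P x × Σ[ q ∈ Reachable G x b ] len q ≤ len p
  suffix here       (here px)  = _ , px , here , z≤n
  suffix (step e p) (here px)  = _ , px , step e p , ≤-refl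
  suffix (step e p) (there xs) with suffix p xs
  ... | x , px , q , q≤p = x , px , q , m≤n⇒m≤1+n q≤p

  suffix-later : ∀ {P : Fin n → Set} (p : Reachable G a b) → Any P (later p) →
                 ∃[ x ] P x × Σ[ q ∈ Reachable G x b ] 2 + len q ≤ len p
  suffix-later (step _ (step _ p)) xs with suffix p xs
  ... | x , px , q , q≤p = x , px , q , s≤s (s≤s q≤p)

  Tightening : Reachable G a b → Set
  Tightening {a} {b} p = Σ[ q ∈ Reachable G a b ] Distinct q × ShortcutFree q × len q ≤ len p

  -- Recursion on a bound L for the length: after cutting back to a repetition of the start a, or taking a
  -- shortcut a → w → x, the walk is tightened again, and it is shorter but not structurally smaller.
  tighten-within : ∀ L (p : Reachable G a b) → len p ≤ L → Tightening p
  tighten-within _       here                   _         = here , tt , tt , z≤n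
  tighten-within (suc L) (step {a} {c} {b} e p) (s≤s p≤L) = extend (tighten-within L p p≤L)
    where
    retry : (q : Reachable G a b) → len q ≤ len p → Tightening (step e p)
    retry q q≤p with tighten-within L q (≤-trans q≤p p≤L)
    ... | r , r-distinct , r-free , r≤q = r , r-distinct , r-free , m≤n⇒m≤1+n (≤-trans r≤q q≤p)

    shortcut? : (p′ : Reachable G c b) → Dec (∃[ w ] T (adj G a w) × Any (λ x → T (adj G x w)) (later p′))
    shortcut? p′ = Fin.any? (λ w → T? (adj G a w) ×-dec Any.any? (λ x → T? (adj G x w)) (later p′))

    extend : Tightening p → Tightening (step e p)
    extend (p′ , p′-distinct , p′-free , p′≤p) with Any.any? (a ≟_) (vertices p′) | shortcut? p′
    ... | yes a∈p′ | _ with suffix p′ a∈p′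
    ...   | _ , refl , q , q≤p′ = retry q (≤-trans q≤p′ p′≤p)
    extend (p′ , p′-distinct , p′-free , p′≤p) | no _ | yes (w , a~w , later~w) with suffix-later p′ later~w
    ...   | _ , x~w , q , 2+q≤p′ = retry (step a~w (step (adj-sym x~w) q)) (≤-trans 2+q≤p′ p′≤p)
    extend (p′ , p′-distinct , p′-free , p′≤p) | no a∉p′ | no no-shortcut =
      step e p′ , (a∉p′ , p′-distinct) , (no-shortcut-from-a , p′-free) , s≤s p′≤p
      where
      no-shortcut-from-a : ∀ w → T (adj G a w) → All (λ x → ¬ T (adj G x w)) (later p′)
      no-shortcut-from-a w a~w = ¬Any⇒All¬ _ (λ later~w → no-shortcut (w , a~w , later~w))

  tighten : (p : Reachable G a b) → Σ[ q ∈ Reachable G a b ] Distinct q × ShortcutFree q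
  tighten p with tighten-within (len p) p ≤-refl
  ... | q , q-distinct , q-free , _ = q , q-distinct , q-free

  neighboursAmong : Fin n → List (Fin n) → ℕ
  neighboursAmong w xs = List.sum (map (λ x → ⟦ adj G x w ⟧) xs)

  neighboursAmong-none : ∀ w xs → All (λ x → ¬ T (adj G x w)) xs → neighboursAmong w xs ≡ 0
  neighboursAmong-none w []       []          = refl
  neighboursAmong-none w (x ∷ xs) (x≁w ∷ xs≁w) = cong₂ _+_ (¬T⇒⟦⟧≡0 x≁w) (neighboursAmong-none w xs xs≁w)

  neighbours-before-later : ∀ w (p : Reachable G a b) → All (λ x → ¬ T (adj G x w)) (later p) →
                            neighboursAmong w (vertices p) ≤ 2
  neighbours-before-later w (here {a})           _ = +-monoˡ-≤ 0 (≤-trans (⟦⟧≤1 (adj G a w)) (s≤s z≤n))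
  neighbours-before-later w (step {a} _ (here {c})) _ =
    +-mono-≤ (⟦⟧≤1 (adj G a w)) (+-mono-≤ (⟦⟧≤1 (adj G c w)) z≤n)
  neighbours-before-later w (step {a} _ (step {c} _ p)) p≁w rewrite neighboursAmong-none w (vertices p) p≁w =
    +-mono-≤ (⟦⟧≤1 (adj G a w)) (+-mono-≤ (⟦⟧≤1 (adj G c w)) z≤n)

  neighbours≤3 : ∀ w (p : Reachable G a b) → ShortcutFree p → neighboursAmong w (vertices p) ≤ 3
  neighbours≤3 w (here {a})       _                  = +-monoˡ-≤ 0 (≤-trans (⟦⟧≤1 (adj G a w)) (s≤s z≤n))
  neighbours≤3 w (step {a} _ p) (no-shortcut , p-free) with adj G a w in a~w
  ... | false = neighbours≤3 w p p-free
  ... | true  = s≤s (neighbours-before-later w p (no-shortcut w (subst T (sym a~w) tt)))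

  degreeSum : Reachable G a b → ℕ
  degreeSum p = List.sum (map (degree G) (vertices p))

  degreeSum≤3n : (p : Reachable G a b) → ShortcutFree p → degreeSum p ≤ 3 * n
  degreeSum≤3n p p-free = begin
    degreeSum p
      ≡⟨ cong List.sum (map-cong (λ x → Σv≡∑ (λ w → ⟦ adj G x w ⟧)) (vertices p)) ⟩
    List.sum (map (λ x → ∑[ w < n ] ⟦ adj G x w ⟧) (vertices p))
      ≡⟨ sum-map-∑ (λ x w → ⟦ adj G x w ⟧) (vertices p) ⟩
    ∑[ w < n ] neighboursAmong w (vertices p)
      ≤⟨ ∑-mono (λ w → neighbours≤3 w p p-free) ⟩
    ∑[ w < n ] 3
      ≡⟨ trans (∑-const n 3) (*-comm n 3) ⟩
    3 * n ∎
    where open ≤-Reasoning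

  cost : Reachable G a b → ℕ
  cost here               = 0
  cost (step {a} {c} _ p) = sqDiff G a c + cost p

  degree-gap≤cost : (p : Reachable G a b) → ∣ degree G a - degree G b ∣ ≤ cost p
  degree-gap≤cost (here {a})           = ≤-reflexive (∣n-n∣≡0 (degree G a))
  degree-gap≤cost (step {a} {c} {b} _ p) =
    ≤-trans (∣-∣-triangle (degree G a) (degree G c) (degree G b)) (+-mono-≤ (m≤m² _) (degree-gap≤cost p))

  traversals : Reachable G a b → Fin n → Fin n → ℕ
  traversals here               u v = 0
  traversals (step {a} {c} _ p) u v = ⟦ ⌊ u ≟ a ⌋ ∧ ⌊ v ≟ c ⌋ ⟧ + ⟦ ⌊ u ≟ c ⌋ ∧ ⌊ v ≟ a ⌋ ⟧ + traversals p u v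

  2cost≡∑²traversals*edgeWeight : (p : Reachable G a b) →
                                  2 * cost p ≡ ∑[ u < n ] ∑[ v < n ] (traversals p u v * edgeWeight u v)
  2cost≡∑²traversals*edgeWeight here = sym (trans (sum-cong-≗ {n} (λ _ → ∑-zero n)) (∑-zero n))
  2cost≡∑²traversals*edgeWeight (step {a} {c} e p) = sym (begin
    ∑∑ (λ u v → (forward u v + backward u v + traversals p u v) * edgeWeight u v)
      ≡⟨ sum-cong-≗ (λ u → sum-cong-≗ (λ v → distrib u v)) ⟩
    ∑∑ (λ u v → fw u v + bw u v + tr u v)
      ≡⟨ ∑²-distrib-+ (λ u v → fw u v + bw u v) tr ⟩
    ∑∑ (λ u v → fw u v + bw u v) + ∑∑ tr
      ≡⟨ cong₂ _+_ (∑²-distrib-+ fw bw) (sym (2cost≡∑²traversals*edgeWeight p)) ⟩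
    ∑∑ fw + ∑∑ bw + 2 * cost p
      ≡⟨ cong (_+ 2 * cost p) (cong₂ _+_ (∑²-pick edgeWeight a c) (∑²-pick edgeWeight c a)) ⟩
    edgeWeight a c + edgeWeight c a + 2 * cost p
      ≡⟨ cong₂ (λ x y → x + y + 2 * cost p) (edgeWeight-edge e) (trans (edgeWeight-sym c a) (edgeWeight-edge e)) ⟩
    sqDiff G a c + sqDiff G a c + 2 * cost p
      ≡⟨ solve 2 (λ x y → x :+ x :+ con 2 :* y := con 2 :* (x :+ y)) refl (sqDiff G a c) (cost p) ⟩
    2 * cost (step e p) ∎)
    where
    open ≡-Reasoning
    ∑∑ : (Fin n → Fin n → ℕ) → ℕ
    ∑∑ f = ∑[ u < n ] ∑[ v < n ] f u v
    forward backward fw bw tr : Fin n → Fin n → ℕ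
    forward  u v = ⟦ ⌊ u ≟ a ⌋ ∧ ⌊ v ≟ c ⌋ ⟧
    backward u v = ⟦ ⌊ u ≟ c ⌋ ∧ ⌊ v ≟ a ⌋ ⟧
    fw u v = forward u v * edgeWeight u v
    bw u v = backward u v * edgeWeight u v
    tr u v = traversals p u v * edgeWeight u v
    distrib : ∀ u v → (forward u v + backward u v + traversals p u v) * edgeWeight u v ≡ fw u v + bw u v + tr u v
    distrib u v = trans (*-distribʳ-+ (edgeWeight u v) (forward u v + backward u v) _)
                        (cong (_+ tr u v) (*-distribʳ-+ (edgeWeight u v) (forward u v) _))

  traversals-sym : (p : Reachable G a b) → ∀ u v → traversals p u v ≡ traversals p v u
  traversals-sym here                 u v = refl
  traversals-sym (step {a} {c} _ p) u v = cong₂ _+_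
    (trans (+-comm ⟦ ⌊ u ≟ a ⌋ ∧ ⌊ v ≟ c ⌋ ⟧ _)
           (cong₂ (λ x y → ⟦ x ⟧ + ⟦ y ⟧) (∧-comm ⌊ u ≟ c ⌋ ⌊ v ≟ a ⌋) (∧-comm ⌊ u ≟ a ⌋ ⌊ v ≟ c ⌋)))
    (traversals-sym p u v)

  traversals-absent : (p : Reachable G a b) → ∀ {u} → u ∉ vertices p → ∀ v → traversals p u v ≡ 0
  traversals-absent here                 u∉p v = refl
  traversals-absent (step {a} {c} _ p) {u} u∉p v
    rewrite ⌊⌋≡false (u ≟ a) (λ u≡a → u∉p (here u≡a))
          | ⌊⌋≡false (u ≟ c) (λ u≡c → u∉p (there (subst (_∈ vertices p) (sym u≡c) (start∈vertices p))))
          = traversals-absent p (u∉p ∘ there) v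

  traversals≤1 : (p : Reachable G a b) → Distinct p → ∀ u v → traversals p u v ≤ 1
  traversals≤1 here                 _                   u v = z≤n
  traversals≤1 (step {a} {c} _ p) (a∉p , p-distinct) u v with u ≟ a | v ≟ a
  ... | yes refl | _
    rewrite ⌊⌋≡false (a ≟ c) (λ a≡c → a∉p (subst (_∈ vertices p) (sym a≡c) (start∈vertices p)))
          | traversals-absent p a∉p v
          = ≤-trans (≤-reflexive (trans (+-identityʳ _) (+-identityʳ _))) (⟦⟧≤1 ⌊ v ≟ c ⌋)
  ... | no _ | yes refl
    rewrite ∧-identityʳ ⌊ u ≟ c ⌋ | traversals-sym p u a | traversals-absent p a∉p u
          = ≤-trans (≤-reflexive (+-identityʳ _)) (⟦⟧≤1 ⌊ u ≟ c ⌋)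
  ... | no _ | no _
    rewrite ∧-zeroʳ ⌊ u ≟ c ⌋ = traversals≤1 p p-distinct u v

  cost≤σ : (p : Reachable G a b) → Distinct p → cost p ≤ σ G
  cost≤σ p p-distinct = *-cancelˡ-≤ 2 (begin
    2 * cost p
      ≡⟨ 2cost≡∑²traversals*edgeWeight p ⟩
    ∑[ u < n ] ∑[ v < n ] (traversals p u v * edgeWeight u v)
      ≤⟨ ∑-mono (λ u → ∑-mono (λ v → once u v)) ⟩
    ∑[ u < n ] ∑[ v < n ] edgeWeight u v
      ≡⟨ 2σ≡∑²edgeWeight ⟨
    2 * σ G ∎)
    where
    open ≤-Reasoning
    once : ∀ u v → traversals p u v * edgeWeight u v ≤ edgeWeight u v
    once u v = ≤-trans (*-monoˡ-≤ (edgeWeight u v) (traversals≤1 p p-distinct u v)) (≤-reflexive (*-identityˡ _))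

  -- j counts the vertices before the first one of degree ≤ t; Cauchy–Schwarz over the j edges leaving them.
  descent : (p : Reachable G a b) (t : ℕ) → t < degree G a → degree G b ≤ t →
            ∃[ j ] 1 ≤ j × j * suc t ≤ degreeSum p × (degree G a ∸ t) ^ 2 ≤ j * cost p
  descent here t t<da db≤t = ⊥-elim (<⇒≱ t<da db≤t)
  descent (step {a} {c} _ p) t t<da db≤t with degree G c ≤? t
  ... | yes dc≤t = 1 , ≤-refl , ≤-trans (≤-reflexive (*-identityˡ (suc t))) (m≤n⇒m≤n+o (degreeSum p) t<da) ,
    (begin
      (degree G a ∸ t) ^ 2
        ≤⟨ ^-monoˡ-≤ 2 (≤-trans (∸-monoʳ-≤ (degree G a) dc≤t) (m∸n≤∣m-n∣ (degree G a) (degree G c))) ⟩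
      sqDiff G a c
        ≤⟨ m≤m+n (sqDiff G a c) (cost p) ⟩
      sqDiff G a c + cost p
        ≡⟨ *-identityˡ _ ⟨
      1 * (sqDiff G a c + cost p) ∎)
    where open ≤-Reasoning
  ... | no dc≰t with descent p t (≰⇒> dc≰t) db≤t
  ...   | j , 1≤j , j[t+1]≤p , [dc-t]²≤jp = suc j , s≤s z≤n , +-mono-≤ t<da j[t+1]≤p ,
    (begin
      (degree G a ∸ t) ^ 2
        ≤⟨ ^-monoˡ-≤ 2 (da∸t≤ (<⇒≤ (≰⇒> dc≰t))) ⟩
      (∣ degree G a - degree G c ∣ + (degree G c ∸ t)) ^ 2
        ≤⟨ [x+y]²≤[1+j][x²+E] j ∣ degree G a - degree G c ∣ (degree G c ∸ t) (cost p) 1≤j [dc-t]²≤jp ⟩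
      suc j * (sqDiff G a c + cost p) ∎)
    where
    open ≤-Reasoning
    da∸t≤ : t ≤ degree G c → degree G a ∸ t ≤ ∣ degree G a - degree G c ∣ + (degree G c ∸ t)
    da∸t≤ t≤dc = ≤-trans (∸-monoˡ-≤ t (m≤∣m-n∣+n (degree G a) (degree G c))) (≤-reflexive (+-∸-assoc _ t≤dc))

  threshold-bound : (p : Reachable G a b) → Distinct p → ShortcutFree p →
                    ∀ t → t < degree G a → degree G b ≤ t → (degree G a ∸ t) ^ 2 * suc t ≤ 3 * n * σ G
  threshold-bound {a} p p-distinct p-free t t<da db≤t with descent p t t<da db≤t
  ... | j , _ , j[t+1]≤p , gap²≤jp = begin
    (degree G a ∸ t) ^ 2 * suc t
      ≤⟨ *-monoˡ-≤ (suc t) (≤-trans gap²≤jp (*-monoʳ-≤ j (cost≤σ p p-distinct))) ⟩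
    j * σ G * suc t
      ≡⟨ solve 3 (λ j s t → j :* s :* t := s :* (j :* t)) refl j (σ G) (suc t) ⟩
    σ G * (j * suc t)
      ≤⟨ *-monoʳ-≤ (σ G) (≤-trans j[t+1]≤p (degreeSum≤3n p p-free)) ⟩
    σ G * (3 * n)
      ≡⟨ *-comm (σ G) (3 * n) ⟩
    3 * n * σ G ∎
    where open ≤-Reasoning

⌈n/2⌉≤1+⌊n/2⌋ : ∀ n → ⌈ n /2⌉ ≤ suc ⌊ n /2⌋
⌈n/2⌉≤1+⌊n/2⌋ zero          = z≤n
⌈n/2⌉≤1+⌊n/2⌋ (suc zero)    = s≤s z≤n
⌈n/2⌉≤1+⌊n/2⌋ (suc (suc n)) = s≤s (⌈n/2⌉≤1+⌊n/2⌋ n)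

n³≤8⌈n/2⌉²[1+⌊n/2⌋] : ∀ n → n ^ 3 ≤ 8 * (⌈ n /2⌉ ^ 2 * suc ⌊ n /2⌋)
n³≤8⌈n/2⌉²[1+⌊n/2⌋] n = begin
  n ^ 3
    ≡⟨ solve 1 (λ n → n :^ 3 := n :* (n :* n)) refl n ⟩
  n * (n * n)
    ≤⟨ *-mono-≤ n≤2s (*-mono-≤ n≤2s n≤2[1+h]) ⟩
  (2 * s) * ((2 * s) * (2 * suc h))
    ≡⟨ solve 2 (λ s h → (con 2 :* s) :* ((con 2 :* s) :* (con 2 :* h)) := con 8 :* (s :^ 2 :* h)) refl s (suc h) ⟩
  8 * (s ^ 2 * suc h) ∎
  where
  open ≤-Reasoning
  h s : ℕ
  h = ⌊ n /2⌋
  s = ⌈ n /2⌉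
  n≤2s : n ≤ 2 * s
  n≤2s = ≤-trans (≤-reflexive (sym (⌊n/2⌋+⌈n/2⌉≡n n))) (+-mono-≤ (⌊n/2⌋≤⌈n/2⌉ n) (≤-reflexive (sym (+-identityʳ s))))
  n≤2[1+h] : n ≤ 2 * suc h
  n≤2[1+h] = ≤-trans (≤-reflexive (sym (⌊n/2⌋+⌈n/2⌉≡n n)))
                     (+-mono-≤ (n≤1+n h) (≤-trans (⌈n/2⌉≤1+⌊n/2⌋ n) (≤-reflexive (sym (+-identityʳ (suc h))))))

-- The threshold t = δ + ⌊D/2⌋ balances the factors: Δ − t = ⌈D/2⌉ and t + 1 > D/2.
[Δ-δ]³≤8C : ∀ {Δ δ C} → δ ≤ Δ → (∀ t → δ ≤ t → t < Δ → (Δ ∸ t) ^ 2 * suc t ≤ C) → (Δ ∸ δ) ^ 3 ≤ 8 * C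
[Δ-δ]³≤8C {Δ} {δ} {C} δ≤Δ bound with 1 ≤? Δ ∸ δ
... | no D≱1  = ≤-trans (≤-reflexive (cong (_^ 3) (n<1⇒n≡0 (≰⇒> D≱1)))) z≤n
... | yes 1≤D = begin
  D ^ 3
    ≤⟨ n³≤8⌈n/2⌉²[1+⌊n/2⌋] D ⟩
  8 * (⌈ D /2⌉ ^ 2 * suc h)
    ≡⟨ cong (λ x → 8 * (x ^ 2 * suc h)) Δ∸θ≡⌈D/2⌉ ⟨
  8 * ((Δ ∸ θ) ^ 2 * suc h)
    ≤⟨ *-monoʳ-≤ 8 (*-monoʳ-≤ ((Δ ∸ θ) ^ 2) (s≤s (m≤n+m h δ))) ⟩
  8 * ((Δ ∸ θ) ^ 2 * suc θ)
    ≤⟨ *-monoʳ-≤ 8 (bound θ (m≤m+n δ h) θ<Δ) ⟩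
  8 * C ∎
  where
  open ≤-Reasoning
  D h θ : ℕ
  D = Δ ∸ δ
  h = ⌊ D /2⌋
  θ = δ + h
  θ<Δ : θ < Δ
  θ<Δ = subst (θ <_) (m+[n∸m]≡n δ≤Δ) (+-monoʳ-< δ (subst (λ x → ⌊ x /2⌋ < x) (m+[n∸m]≡n 1≤D) (⌊n/2⌋<n (D ∸ 1))))
  Δ∸θ≡⌈D/2⌉ : Δ ∸ θ ≡ ⌈ D /2⌉
  Δ∸θ≡⌈D/2⌉ = begin-equality
    Δ ∸ (δ + h)
      ≡⟨ ∸-+-assoc Δ δ h ⟨
    D ∸ h
      ≡⟨ cong (_∸ h) (⌊n/2⌋+⌈n/2⌉≡n D) ⟨
    h + ⌈ D /2⌉ ∸ h
      ≡⟨ m+n∸m≡n h _ ⟩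
    ⌈ D /2⌉ ∎

2a²≤3n⁵b² : ∀ {n D a b} → 4 * a ≤ (n * D) ^ 2 → D ≤ b → D ^ 3 ≤ 24 * n * b → 2 * a ^ 2 ≤ 3 * n ^ 5 * b ^ 2
2a²≤3n⁵b² {n} {D} {a} {b} 4a≤[nD]² D≤b D³≤24nb = *-cancelˡ-≤ 16 (begin
  16 * (2 * a ^ 2)
    ≡⟨ solve 1 (λ a → con 16 :* (con 2 :* a :^ 2) := con 2 :* (con 4 :* a) :^ 2) refl a ⟩
  2 * (4 * a) ^ 2
    ≤⟨ *-monoʳ-≤ 2 (^-monoˡ-≤ 2 4a≤[nD]²) ⟩
  2 * ((n * D) ^ 2) ^ 2
    ≡⟨ solve 2 (λ n d → con 2 :* ((n :* d) :^ 2) :^ 2 := con 2 :* n :^ 4 :* (d :* d :^ 3)) refl n D ⟩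
  2 * n ^ 4 * (D * D ^ 3)
    ≤⟨ *-monoʳ-≤ (2 * n ^ 4) (*-mono-≤ D≤b D³≤24nb) ⟩
  2 * n ^ 4 * (b * (24 * n * b))
    ≡⟨ solve 2 (λ n b → con 2 :* n :^ 4 :* (b :* (con 24 :* n :* b)) := con 16 :* (con 3 :* n :^ 5 :* b :^ 2)) refl n b ⟩
  16 * (3 * n ^ 5 * b ^ 2) ∎)
  where open ≤-Reasoning

module _ {m : ℕ} (G : SimpleGraph (suc m)) where
  private
    n : ℕ
    n = suc m

  maxDegreeVertex minDegreeVertex : Fin n
  maxDegreeVertex = argmax (degree G) zero (allFin n)
  minDegreeVertex = argmin (degree G) zero (allFin n)

  Δ δ spread : ℕ
  Δ = degree G maxDegreeVertex
  δ = degree G minDegreeVertex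
  spread = Δ ∸ δ

  degree≤Δ : ∀ u → degree G u ≤ Δ
  degree≤Δ u = All.lookup (f[xs]≤f[argmax] {f = degree G} zero (allFin n)) (∈-allFin u)

  δ≤degree : ∀ u → δ ≤ degree G u
  δ≤degree u = All.lookup (f[argmin]≤f[xs] {f = degree G} zero (allFin n)) (∈-allFin u)

  4σt≤[n*spread]² : 4 * σt G ≤ (n * spread) ^ 2
  4σt≤[n*spread]² = begin
    4 * σt G
      ≡⟨ *-assoc 2 2 (σt G) ⟩
    2 * (2 * σt G)
      ≡⟨ cong (2 *_) (2σt≡∑²sqDiff G) ⟩
    2 * ∑[ u < n ] ∑[ v < n ] sqDiff G u v
      ≡⟨ cong (2 *_) (sum-cong-≗ (λ u → sum-cong-≗ (λ v → cong (_^ 2) (shift u v)))) ⟩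
    2 * ∑[ u < n ] ∑[ v < n ] (∣ y u - y v ∣ ^ 2)
      ≤⟨ variance-bound y spread (λ u → ∸-monoˡ-≤ δ (degree≤Δ u)) ⟩
    (n * spread) ^ 2 ∎
    where
    open ≤-Reasoning
    y : Fin n → ℕ
    y u = degree G u ∸ δ
    shift : ∀ u v → ∣ degree G u - degree G v ∣ ≡ ∣ y u - y v ∣
    shift u v = trans (cong₂ ∣_-_∣ (sym (m+[n∸m]≡n (δ≤degree u))) (sym (m+[n∸m]≡n (δ≤degree v))))
                      (∣m+n-m+o∣≡∣n-o∣ δ (y u) (y v))

  module _ (connected : Connected G) where
    private
      extremal-path : Σ[ q ∈ Reachable G maxDegreeVertex minDegreeVertex ] Distinct G q × ShortcutFree G q
      extremal-path = tighten G (connected maxDegreeVertex minDegreeVertex)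
      q : Reachable G maxDegreeVertex minDegreeVertex
      q = proj₁ extremal-path
      q-distinct : Distinct G q
      q-distinct = proj₁ (proj₂ extremal-path)
      q-free : ShortcutFree G q
      q-free = proj₂ (proj₂ extremal-path)

    spread≤σ : spread ≤ σ G
    spread≤σ = ≤-trans (m∸n≤∣m-n∣ Δ δ) (≤-trans (degree-gap≤cost G q) (cost≤σ G q q-distinct))

    spread³≤24nσ : spread ^ 3 ≤ 24 * n * σ G
    spread³≤24nσ = ≤-trans ([Δ-δ]³≤8C (δ≤degree maxDegreeVertex) threshold)
                           (≤-reflexive (solve 2 (λ n s → con 8 :* (con 3 :* n :* s) := con 24 :* n :* s) refl n (σ G)))
      where
      threshold : ∀ t → δ ≤ t → t < Δ → (Δ ∸ t) ^ 2 * suc t ≤ 3 * n * σ G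
      threshold t δ≤t t<Δ = threshold-bound G q q-distinct q-free t t<Δ δ≤t

2σt²≤3n⁵σ² : (n : ℕ) (G : SimpleGraph n) → Connected G → 2 * σt G ^ 2 ≤ 3 * n ^ 5 * σ G ^ 2
2σt²≤3n⁵σ² zero    G _         = z≤n
2σt²≤3n⁵σ² (suc m) G connected =
  2a²≤3n⁵b² {suc m} {spread G} {σt G} {σ G} (4σt≤[n*spread]² G) (spread≤σ G connected) (spread³≤24nσ G connected)

module _ {n : ℕ} (G : SimpleGraph n) where
  private
    variable
      a b c : Fin n

  _++ʷ_ : Reachable G a b → Reachable G b c → Reachable G a c
  here     ++ʷ q = q
  step e p ++ʷ q = step e (p ++ʷ q)

  reverseʷ : Reachable G a b → Reachable G b a
  reverseʷ here       = here
  reverseʷ (step e p) = reverseʷ p ++ʷ step (adj-sym G e) here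

  descend : (lev : Fin n → ℕ) → (∀ u → 0 < lev u → ∃[ w ] T (adj G u w) × lev w < lev u) →
            ∀ k u → lev u ≤ k → ∃[ z ] lev z ≡ 0 × Reachable G u z
  descend lev down k u lu≤k with lev u in lu
  ... | zero = u , lu , here
  descend lev down (suc k) u (s≤s l≤k) | suc l with down u (subst (0 <_) (sym lu) z<s)
  ...   | w , u~w , lw<lu with descend lev down k w (≤-trans (≤-pred (subst (lev w <_) lu lw<lu)) l≤k)
  ...     | z , lz , w→z = z , lz , step u~w w→z

  connected-by-descent : (lev : Fin n → ℕ) → (∀ u → 0 < lev u → ∃[ w ] T (adj G u w) × lev w < lev u) →
                         (∀ u v → lev u ≡ 0 → lev v ≡ 0 → Reachable G u v) → Connected G
  connected-by-descent lev down ground u v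
    with descend lev down (lev u) u ≤-refl | descend lev down (lev v) v ≤-refl
  ... | zu , lzu , u→zu | zv , lzv , v→zv = u→zu ++ʷ (ground zu zv lzu lzv ++ʷ reverseʷ v→zv)

  cross-gap≤2σt : (X Y : Fin n → Bool) (g : ℕ) →
                  (∀ u v → T (X u) → T (Y v) → g ≤ ∣ degree G u - degree G v ∣) →
                  (∑[ u < n ] ⟦ X u ⟧) * (∑[ v < n ] ⟦ Y v ⟧) * g ^ 2 ≤ 2 * σt G
  cross-gap≤2σt X Y g gap = begin
    (∑[ u < n ] ⟦ X u ⟧) * (∑[ v < n ] ⟦ Y v ⟧) * g ^ 2
      ≡⟨ *-assoc (sum (⟦_⟧ ∘ X)) _ (g ^ 2) ⟩
    (∑[ u < n ] ⟦ X u ⟧) * ((∑[ v < n ] ⟦ Y v ⟧) * g ^ 2)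
      ≡⟨ *-distribʳ-sum _ (⟦_⟧ ∘ X) ⟩
    ∑[ u < n ] (⟦ X u ⟧ * ((∑[ v < n ] ⟦ Y v ⟧) * g ^ 2))
      ≡⟨ sum-cong-≗ (λ u → cong (⟦ X u ⟧ *_) (*-distribʳ-sum (g ^ 2) (⟦_⟧ ∘ Y))) ⟩
    ∑[ u < n ] (⟦ X u ⟧ * ∑[ v < n ] (⟦ Y v ⟧ * g ^ 2))
      ≡⟨ sum-cong-≗ (λ u → *-distribˡ-sum ⟦ X u ⟧ (λ v → ⟦ Y v ⟧ * g ^ 2)) ⟩
    ∑[ u < n ] ∑[ v < n ] (⟦ X u ⟧ * (⟦ Y v ⟧ * g ^ 2))
      ≤⟨ ∑-mono (λ u → ∑-mono (λ v → pair u v)) ⟩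
    ∑[ u < n ] ∑[ v < n ] sqDiff G u v
      ≡⟨ 2σt≡∑²sqDiff G ⟨
    2 * σt G ∎
    where
    open ≤-Reasoning
    pair : ∀ u v → ⟦ X u ⟧ * (⟦ Y v ⟧ * g ^ 2) ≤ sqDiff G u v
    pair u v with X u in xu | Y v in yv
    ... | false | _     = z≤n
    ... | true  | false = z≤n
    ... | true  | true  = ≤-trans (≤-reflexive (trans (+-identityʳ _) (+-identityʳ _)))
                                  (^-monoˡ-≤ 2 (gap u v (subst T (sym xu) tt) (subst T (sym yv) tt)))

near : ℕ → ℕ → Bool
near l x = ∣ l - x ∣ ≤ᵇ 1

near-refl : ∀ l → near l l ≡ true
near-refl l rewrite ∣n-n∣≡0 l = refl

⟦near⟧≡ : ∀ l x → ⟦ near l x ⟧ ≡ ⟦ suc x ≡ᵇ l ⟧ + ⟦ x ≡ᵇ l ⟧ + ⟦ x ≡ᵇ suc l ⟧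
⟦near⟧≡ zero          zero          = refl
⟦near⟧≡ zero          (suc zero)    = refl
⟦near⟧≡ zero          (suc (suc x)) = refl
⟦near⟧≡ (suc zero)    zero          = refl
⟦near⟧≡ (suc (suc l)) zero          = refl
⟦near⟧≡ (suc l)       (suc x)       = ⟦near⟧≡ l x

near-jump : ∀ (F : ℕ → ℕ) l x → T (near l x) →
            ∣ F l - F x ∣ ^ 2 ≤ ⟦ x ≡ᵇ suc l ⟧ * ∣ F l - F (suc l) ∣ ^ 2 + ⟦ l ≡ᵇ suc x ⟧ * ∣ F x - F (suc x) ∣ ^ 2
near-jump F zero       zero       _ = ≤-trans (≤-reflexive (cong (_^ 2) (∣n-n∣≡0 (F 0)))) z≤n
near-jump F zero       (suc zero) _ = ≤-reflexive (sym (trans (+-identityʳ _) (*-identityˡ _)))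
near-jump F (suc zero) zero       _ = ≤-reflexive (trans (cong (_^ 2) (∣-∣-comm (F 1) (F 0))) (sym (*-identityˡ _)))
near-jump F (suc l)    (suc x)    t = near-jump (F ∘ suc) l x t

module LevelGraph {n : ℕ} (lev : Fin n → ℕ) where

  levelAdj : Fin n → Fin n → Bool
  levelAdj u v = not ⌊ u ≟ v ⌋ ∧ near (lev u) (lev v)

  levelAdj-sym : ∀ u v → levelAdj u v ≡ levelAdj v u
  levelAdj-sym u v = cong₂ (λ x y → not x ∧ y) (≟-sym u v) (cong (_≤ᵇ 1) (∣-∣-comm (lev u) (lev v)))
    where
    ≟-sym : ∀ u v → ⌊ u ≟ v ⌋ ≡ ⌊ v ≟ u ⌋
    ≟-sym u v with u ≟ v | v ≟ u
    ... | yes _   | yes _   = refl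
    ... | no _    | no _    = refl
    ... | yes u≡v | no v≢u  = ⊥-elim (v≢u (sym u≡v))
    ... | no u≢v  | yes v≡u = ⊥-elim (u≢v (sym v≡u))

  levelAdj-irrefl : ∀ u → levelAdj u u ≡ false
  levelAdj-irrefl u with u ≟ u
  ... | yes _  = refl
  ... | no u≢u = ⊥-elim (u≢u refl)

  graph : SimpleGraph n
  graph = record { adj = levelAdj ; sym = levelAdj-sym ; irrefl = levelAdj-irrefl }

  -- #below l counts level l − 1, and is 0 for l = 0 (not level 0 again, as l ∸ 1 would give).
  #at #below #near : ℕ → ℕ
  #at    l = ∑[ v < n ] ⟦ lev v ≡ᵇ l ⟧
  #below l = ∑[ v < n ] ⟦ suc (lev v) ≡ᵇ l ⟧
  #near  l = ∑[ v < n ] ⟦ near l (lev v) ⟧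

  #below-zero : #below 0 ≡ 0
  #below-zero = ∑-zero n

  #near≡ : ∀ l → #near l ≡ #below l + #at l + #at (suc l)
  #near≡ l = trans (sum-cong-≗ (λ v → ⟦near⟧≡ l (lev v)))
                   (trans (∑-distrib-+ (λ v → ⟦ suc (lev v) ≡ᵇ l ⟧ + ⟦ lev v ≡ᵇ l ⟧) _)
                          (cong (_+ #at (suc l)) (∑-distrib-+ (λ v → ⟦ suc (lev v) ≡ᵇ l ⟧) _)))

  #near-step : ∀ l → ∣ #near l - #near (suc l) ∣ ≡ ∣ #below l - #at (suc (suc l)) ∣
  #near-step l = begin
    ∣ #near l - #near (suc l) ∣
      ≡⟨ cong₂ ∣_-_∣ (#near≡ l) (#near≡ (suc l)) ⟩
    ∣ #below l + #at l + #at (suc l) - a + #at (suc (suc l)) ∣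
      ≡⟨ cong (λ x → ∣ x - a + #at (suc (suc l)) ∣) (trans (+-assoc (#below l) _ _) (+-comm (#below l) a)) ⟩
    ∣ a + #below l - a + #at (suc (suc l)) ∣
      ≡⟨ ∣m+n-m+o∣≡∣n-o∣ a (#below l) _ ⟩
    ∣ #below l - #at (suc (suc l)) ∣ ∎
    where
    open ≡-Reasoning
    a : ℕ
    a = #at l + #at (suc l)

  suc-degree≡#near : ∀ u → suc (degree graph u) ≡ #near (lev u)
  suc-degree≡#near u = begin
    suc (degree graph u)
      ≡⟨ +-comm 1 (degree graph u) ⟩
    degree graph u + 1
      ≡⟨ cong₂ _+_ (sym (Σv≡∑ (λ v → ⟦ levelAdj u v ⟧))) (∑-pick (λ _ → 1) u) ⟨
    ∑[ v < n ] ⟦ levelAdj u v ⟧ + ∑[ v < n ] (⟦ ⌊ v ≟ u ⌋ ⟧ * 1)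
      ≡⟨ ∑-distrib-+ (λ v → ⟦ levelAdj u v ⟧) (λ v → ⟦ ⌊ v ≟ u ⌋ ⟧ * 1) ⟨
    ∑[ v < n ] (⟦ levelAdj u v ⟧ + ⟦ ⌊ v ≟ u ⌋ ⟧ * 1)
      ≡⟨ sum-cong-≗ pointwise ⟩
    #near (lev u) ∎
    where
    open ≡-Reasoning
    pointwise : ∀ v → ⟦ levelAdj u v ⟧ + ⟦ ⌊ v ≟ u ⌋ ⟧ * 1 ≡ ⟦ near (lev u) (lev v) ⟧
    pointwise v with v ≟ u
    ... | yes refl rewrite levelAdj-irrefl v | near-refl (lev v) = refl
    ... | no v≢u   rewrite ⌊⌋≡false (u ≟ v) (v≢u ∘ sym) = +-identityʳ _

  levelAdj⇒near : ∀ {u v} → T (levelAdj u v) → T (near (lev u) (lev v))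
  levelAdj⇒near = proj₂ ∘ Equivalence.to T-∧

  levelJump : ℕ → ℕ
  levelJump l = ∣ #near l - #near (suc l) ∣ ^ 2

  edgeWeight≤levelJumps : ∀ u v → edgeWeight graph u v ≤
    ⟦ lev v ≡ᵇ suc (lev u) ⟧ * levelJump (lev u) + ⟦ lev u ≡ᵇ suc (lev v) ⟧ * levelJump (lev v)
  edgeWeight≤levelJumps u v with levelAdj u v in u~v
  ... | false = z≤n
  ... | true  = ≤-trans (≤-reflexive (cong (_^ 2) (cong₂ ∣_-_∣ (suc-degree≡#near u) (suc-degree≡#near v))))
                      (near-jump #near (lev u) (lev v) (levelAdj⇒near (subst T (sym u~v) tt)))

  σ≤∑levelJumps : σ graph ≤ ∑[ u < n ] (#at (suc (lev u)) * levelJump (lev u))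
  σ≤∑levelJumps = *-cancelˡ-≤ 2 (begin
    2 * σ graph
      ≡⟨ 2σ≡∑²edgeWeight graph ⟩
    ∑[ u < n ] ∑[ v < n ] edgeWeight graph u v
      ≤⟨ ∑-mono (λ u → ∑-mono (edgeWeight≤levelJumps u)) ⟩
    ∑[ u < n ] ∑[ v < n ] (up u v + up v u)
      ≡⟨ ∑²-distrib-+ up (λ u v → up v u) ⟩
    ∑[ u < n ] ∑[ v < n ] up u v + ∑[ u < n ] ∑[ v < n ] up v u
      ≡⟨ cong (S +_) (∑-comm (λ u v → up v u)) ⟩
    S + S
      ≡⟨ cong (S +_) (+-identityʳ S) ⟨
    2 * S
      ≡⟨ cong (2 *_) (sum-cong-≗ (λ u → *-distribʳ-sum (levelJump (lev u)) (λ v → ⟦ lev v ≡ᵇ suc (lev u) ⟧))) ⟨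
    2 * ∑[ u < n ] (#at (suc (lev u)) * levelJump (lev u)) ∎)
    where
    open ≤-Reasoning
    up : Fin n → Fin n → ℕ
    up u v = ⟦ lev v ≡ᵇ suc (lev u) ⟧ * levelJump (lev u)
    S : ℕ
    S = ∑[ u < n ] ∑[ v < n ] up u v

  near-suc : ∀ l → near (suc l) l ≡ true
  near-suc zero    = refl
  near-suc (suc l) = near-suc l

  connected : (∀ u → 0 < lev u → ∃[ w ] suc (lev w) ≡ lev u) → Connected graph
  connected below = connected-by-descent graph lev down ground
    where
    down : ∀ u → 0 < lev u → ∃[ w ] T (levelAdj u w) × lev w < lev u
    down u pos with below u pos
    ... | w , lw+1≡lu = w , subst T (sym u~w) tt , subst (lev w <_) lw+1≡lu ≤-refl
      where
      u~w : levelAdj u w ≡ true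
      u~w = cong₂ (λ x y → not x ∧ y) (⌊⌋≡false (u ≟ w) (λ { refl → 1+n≢n lw+1≡lu }))
                  (trans (cong (λ l → near l (lev w)) (sym lw+1≡lu)) (near-suc (lev w)))
    ground : ∀ u v → lev u ≡ 0 → lev v ≡ 0 → Reachable graph u v
    ground u v lu lv with u ≟ v
    ... | yes refl = here
    ... | no u≢v   = step (subst T (sym u~v) tt) here
      where
      u~v : levelAdj u v ≡ true
      u~v rewrite ⌊⌋≡false (u ≟ v) u≢v | lu | lv = refl

∑ℕ : ℕ → (ℕ → ℕ) → ℕ
∑ℕ L g = ∑[ i < L ] g (toℕ i)

∑ℕ-+ : ∀ a b (g : ℕ → ℕ) → ∑ℕ (a + b) g ≡ ∑ℕ a g + ∑ℕ b (λ i → g (a + i))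
∑ℕ-+ zero    b g = refl
∑ℕ-+ (suc a) b g = trans (cong (g 0 +_) (∑ℕ-+ a b (g ∘ suc))) (sym (+-assoc (g 0) _ _))

∑ℕ-blocks : ∀ B (g : ℕ → ℕ) → ∑ℕ (B * 3) g ≡ ∑ℕ B (λ j → g (j * 3) + g (suc (j * 3)) + g (suc (suc (j * 3))))
∑ℕ-blocks zero    g = refl
∑ℕ-blocks (suc B) g = trans (cong (λ x → g 0 + (g 1 + (g 2 + x))) (∑ℕ-blocks B (λ i → g (3 + i))))
                            (sym (trans (+-assoc (g 0 + g 1) (g 2) _) (+-assoc (g 0) (g 1) _)))

∑ℕ-pick : ∀ L (g : ℕ → ℕ) l → ∑ℕ L (λ i → g i * ⟦ i ≡ᵇ l ⟧) ≡ ⟦ l <ᵇ L ⟧ * g l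
∑ℕ-pick zero    g l       = refl
∑ℕ-pick (suc L) g zero    =
  cong₂ _+_ (*-identityʳ (g 0)) (trans (sum-cong-≗ {L} (λ i → *-zeroʳ (g (suc (toℕ i))))) (∑-zero L))
∑ℕ-pick (suc L) g (suc l) =
  trans (cong (_+ ∑ℕ L (λ i → g (suc i) * ⟦ i ≡ᵇ l ⟧)) (*-zeroʳ (g 0))) (∑ℕ-pick L (g ∘ suc) l)

∑-lookup : ∀ (xs : List ℕ) (h : ℕ → ℕ) → ∑[ i < length xs ] h (lookup xs i) ≡ List.sum (map h xs)
∑-lookup []       h = refl
∑-lookup (x ∷ xs) h = cong (h x +_) (∑-lookup xs h)

sum-replicate : ∀ k x → List.sum (replicate k x) ≡ k * x
sum-replicate zero    x = refl
sum-replicate (suc k) x = cong (x +_) (sum-replicate k x)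

levels : (ℕ → ℕ) → ℕ → List ℕ
levels f zero    = []
levels f (suc L) = replicate (f 0) 0 ++ map suc (levels (f ∘ suc) L)

sum-map-levels : ∀ (f : ℕ → ℕ) L (h : ℕ → ℕ) → List.sum (map h (levels f L)) ≡ ∑ℕ L (λ l → f l * h l)
sum-map-levels f zero    h = refl
sum-map-levels f (suc L) h = begin
  List.sum (map h (replicate (f 0) 0 ++ map suc ls))
    ≡⟨ cong List.sum (map-++ h (replicate (f 0) 0) _) ⟩
  List.sum (map h (replicate (f 0) 0) ++ map h (map suc ls))
    ≡⟨ List.sum-++ (map h (replicate (f 0) 0)) _ ⟩
  List.sum (map h (replicate (f 0) 0)) + List.sum (map h (map suc ls))
    ≡⟨ cong₂ _+_ (trans (cong List.sum (map-replicate h (f 0) 0)) (sum-replicate (f 0) (h 0)))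
                 (trans (cong List.sum (sym (map-∘ ls))) (sum-map-levels (f ∘ suc) L (h ∘ suc))) ⟩
  f 0 * h 0 + ∑ℕ L (λ l → f (suc l) * h (suc l)) ∎
  where
  open ≡-Reasoning
  ls : List ℕ
  ls = levels (f ∘ suc) L

length-levels : ∀ (f : ℕ → ℕ) L → length (levels f L) ≡ ∑ℕ L f
length-levels f zero    = refl
length-levels f (suc L) = trans (length-++ (replicate (f 0) 0))
  (cong₂ _+_ (length-replicate (f 0)) (trans (length-map suc (levels (f ∘ suc) L)) (length-levels (f ∘ suc) L)))

≡ᵇ-refl : ∀ l → (l ≡ᵇ l) ≡ true
≡ᵇ-refl zero    = refl
≡ᵇ-refl (suc l) = ≡ᵇ-refl l

⟦⟧-pos : ∀ {b} → 0 < ⟦ b ⟧ → T b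
⟦⟧-pos {true} _ = tt

module LevelProfile (f : ℕ → ℕ) (L : ℕ) where

  open LevelGraph (lookup (levels f L)) public

  order : ℕ
  order = length (levels f L)

  lev : Fin order → ℕ
  lev = lookup (levels f L)

  ∑-by-level : ∀ h → ∑[ u < order ] h (lev u) ≡ ∑ℕ L (λ l → f l * h l)
  ∑-by-level h = trans (∑-lookup (levels f L) h) (sum-map-levels f L h)

  #at≡ : ∀ l → #at l ≡ ⟦ l <ᵇ L ⟧ * f l
  #at≡ l = trans (∑-by-level (λ x → ⟦ x ≡ᵇ l ⟧)) (∑ℕ-pick L f l)


  #at-inside : ∀ {l} → l < L → #at l ≡ f l
  #at-inside {l} l<L rewrite #at≡ l with l <ᵇ L in l<ᵇL
  ... | true  = +-identityʳ (f l)
  ... | false = ⊥-elim (subst T l<ᵇL (<⇒<ᵇ l<L))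

  #at-outside : ∀ {l} → L ≤ l → #at l ≡ 0
  #at-outside {l} L≤l rewrite #at≡ l with l <ᵇ L in l<ᵇL
  ... | false = refl
  ... | true  = ⊥-elim (<⇒≱ (<ᵇ⇒< l L (subst T (sym l<ᵇL) tt)) L≤l)

  lev<L : ∀ u → lev u < L
  lev<L u with L ≤? lev u
  ... | no L≰lu  = ≰⇒> L≰lu
  ... | yes L≤lu = ⊥-elim (n≮0 (subst (0 <_) (#at-outside L≤lu) occupied))
    where
    occupied : 0 < #at (lev u)
    occupied = ≤-trans (≤-reflexive (cong ⟦_⟧ (sym (≡ᵇ-refl (lev u))))) (f≤∑f (λ v → ⟦ lev v ≡ᵇ lev u ⟧) u)

  connected-profile : (∀ l → l < L → 1 ≤ f l) → Connected graph
  connected-profile f≥1 = connected below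
    where
    below : ∀ u → 0 < lev u → ∃[ w ] suc (lev w) ≡ lev u
    below u _ with lev u in lu | lev<L u
    ... | suc k | k+1<L with ∑-positive (λ v → ⟦ lev v ≡ᵇ k ⟧) (subst (0 <_) (sym (#at-inside k<L)) (f≥1 k k<L))
      where
      k<L : k < L
      k<L = ≤-trans (n≤1+n (suc k)) k+1<L
    ...   | w , lw≡k = w , cong suc (≡ᵇ⇒≡ (lev w) k (⟦⟧-pos lw≡k))

  σ≤∑ℕ : σ graph ≤ ∑ℕ L (λ l → f l * (#at (suc l) * ∣ #below l - #at (suc (suc l)) ∣ ^ 2))
  σ≤∑ℕ = ≤-trans σ≤∑levelJumps (≤-reflexive (trans (∑-by-level (λ l → #at (suc l) * levelJump l))
    (sum-cong-≗ {L} (λ i → cong (λ x → f (toℕ i) * (#at (suc (toℕ i)) * x ^ 2)) (#near-step (toℕ i))))))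

term≤1 : ∀ {a b x y} → a ≤ 1 → b ≤ 1 → ∣ x - y ∣ ≤ 1 → a * (b * ∣ x - y ∣ ^ 2) ≤ 1
term≤1 a≤1 b≤1 d≤1 = *-mono-≤ a≤1 (*-mono-≤ b≤1 (*-mono-≤ d≤1 (*-mono-≤ d≤1 (≤-refl {1}))))

term≡0 : ∀ a b x → a * (b * ∣ x - x ∣ ^ 2) ≡ 0
term≡0 a b x rewrite ∣n-n∣≡0 x | *-zeroʳ b = *-zeroʳ a

∣x-y∣≤1 : ∀ {x y} → x ≤ 1 → y ≤ 1 → ∣ x - y ∣ ≤ 1
∣x-y∣≤1 {x} {y} x≤1 y≤1 = ≤-trans (∣m-n∣≤m⊔n x y) (⊔-lub x≤1 y≤1)

-- Levels 3j, 3j + 1, 3j + 2 have sizes 1 + s j, 1, 1. Thanks to the two singleton levels, the only edge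
-- whose end degrees involve both s j and s (j + 1) is the one between them, of weight (s j − s (j + 1))².
blockProfile : (ℕ → ℕ) → ℕ → ℕ
blockProfile s zero                = suc (s 0)
blockProfile s (suc zero)          = 1
blockProfile s (suc (suc zero))    = 1
blockProfile s (suc (suc (suc l))) = blockProfile (s ∘ suc) l

blockProfile-head : ∀ s j → blockProfile s (j * 3) ≡ suc (s j)
blockProfile-head s zero    = refl
blockProfile-head s (suc j) = blockProfile-head (s ∘ suc) j

blockProfile-link₁ : ∀ s j → blockProfile s (suc (j * 3)) ≡ 1
blockProfile-link₁ s zero    = refl
blockProfile-link₁ s (suc j) = blockProfile-link₁ (s ∘ suc) j

blockProfile-link₂ : ∀ s j → blockProfile s (suc (suc (j * 3))) ≡ 1
blockProfile-link₂ s zero    = refl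
blockProfile-link₂ s (suc j) = blockProfile-link₂ (s ∘ suc) j

blockProfile-flat : ∀ s j → (∀ i → s (j + i) ≡ 0) → ∀ k → blockProfile s (j * 3 + k) ≡ 1
blockProfile-flat s (suc j) s≡0 k                   = blockProfile-flat (s ∘ suc) j s≡0 k
blockProfile-flat s zero    s≡0 zero                = cong suc (s≡0 0)
blockProfile-flat s zero    s≡0 (suc zero)          = refl
blockProfile-flat s zero    s≡0 (suc (suc zero))    = refl
blockProfile-flat s zero    s≡0 (suc (suc (suc k))) = blockProfile-flat (s ∘ suc) zero (s≡0 ∘ suc) k

blockProfile≤ : ∀ s c → (∀ j → s j ≤ c) → ∀ l → blockProfile s l ≤ suc c
blockProfile≤ s c s≤c zero                = s≤s (s≤c 0)
blockProfile≤ s c s≤c (suc zero)          = s≤s z≤n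
blockProfile≤ s c s≤c (suc (suc zero))    = s≤s z≤n
blockProfile≤ s c s≤c (suc (suc (suc l))) = blockProfile≤ (s ∘ suc) c (s≤c ∘ suc) l

blockProfile≥1 : ∀ s l → 1 ≤ blockProfile s l
blockProfile≥1 s zero                = s≤s z≤n
blockProfile≥1 s (suc zero)          = s≤s z≤n
blockProfile≥1 s (suc (suc zero))    = s≤s z≤n
blockProfile≥1 s (suc (suc (suc l))) = blockProfile≥1 (s ∘ suc) l

tent : ℕ → ℕ → ℕ
tent M j = j ⊓ (M ∸ j)

∣x⊓y-[1+x]⊓[y-1]∣≤1 : ∀ x y → ∣ x ⊓ y - suc x ⊓ (y ∸ 1) ∣ ≤ 1
∣x⊓y-[1+x]⊓[y-1]∣≤1 zero    y             = m⊓n≤m 1 (y ∸ 1)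
∣x⊓y-[1+x]⊓[y-1]∣≤1 (suc x) zero          = z≤n
∣x⊓y-[1+x]⊓[y-1]∣≤1 (suc x) (suc zero)    = s≤s (m⊓n≤n x 0)
∣x⊓y-[1+x]⊓[y-1]∣≤1 (suc x) (suc (suc y)) = ∣x⊓y-[1+x]⊓[y-1]∣≤1 x (suc y)

tent-step : ∀ M j → ∣ tent M j - tent M (suc j) ∣ ≤ 1
tent-step M j = subst (λ z → ∣ tent M j - suc j ⊓ z ∣ ≤ 1) (trans (∸-+-assoc M j 1) (cong (M ∸_) (+-comm j 1)))
                      (∣x⊓y-[1+x]⊓[y-1]∣≤1 j (M ∸ j))

tent-beyond : ∀ M j → M ≤ j → tent M j ≡ 0
tent-beyond M j M≤j = trans (cong (j ⊓_) (m≤n⇒m∸n≡0 M≤j)) (⊓-zeroʳ j)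

tent≤ : ∀ M j → tent M j ≤ M
tent≤ M j = ≤-trans (m⊓n≤n j (M ∸ j)) (m∸n≤m M j)

tent-middle : ∀ K j → K ≤ j → j ≤ K + K → K ≤ tent (3 * K) j
tent-middle K j K≤j j≤2K = ⊓-glb K≤j (begin
  K
    ≡⟨ m+n∸n≡m K (K + K) ⟨
  K + (K + K) ∸ (K + K)
    ≤⟨ ∸-monoʳ-≤ (K + (K + K)) j≤2K ⟩
  K + (K + K) ∸ j
    ≡⟨ cong (λ x → K + (K + x) ∸ j) (+-identityʳ K) ⟨
  3 * K ∸ j ∎)
  where open ≤-Reasoning

T⇒≡true : ∀ {b} → T b → b ≡ true
T⇒≡true {true} _ = refl

⟦b⟧*x≤x : ∀ b x → ⟦ b ⟧ * x ≤ x
⟦b⟧*x≤x true  x = ≤-reflexive (+-identityʳ x)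
⟦b⟧*x≤x false x = z≤n

module TentProfile (K : ℕ) where

  M P : ℕ
  M = 3 * K
  P = suc M * 3

  profile : ℕ → ℕ
  profile = blockProfile (tent M)

  M*3≤a+[M*3+k] : ∀ a k → M * 3 ≤ a + (M * 3 + k)
  M*3≤a+[M*3+k] a k = ≤-trans (m≤m+n (M * 3) k) (m≤n+m _ a)

  profile-tail : ∀ {l} → M * 3 ≤ l → profile l ≡ 1
  profile-tail {l} M*3≤l = trans (cong profile (sym (m+[n∸m]≡n M*3≤l)))
    (blockProfile-flat (tent M) M (λ i → tent-beyond M (M + i) (m≤m+n M i)) (l ∸ M * 3))

  head-size≤ : ∑ℕ P profile ≤ P * suc M
  head-size≤ = ≤-trans (∑-mono {P} (λ i → blockProfile≤ (tent M) M (tent≤ M) (toℕ i)))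
                       (≤-reflexive (∑-const P (suc M)))

-- Head: the blocks j ≤ 3K of tent (3K), of which the K + 1 middle ones have at least K + 1 vertices;
-- tail: R′ + 2 singleton levels, whose vertices have degree at most 2.
module Construction (K R′ : ℕ) where

  open TentProfile K public

  L : ℕ
  L = P + (R′ + 2)

  open LevelProfile profile L public

  #at≤1 : ∀ {l} → M * 3 ≤ l → #at l ≤ 1
  #at≤1 {l} M*3≤l = ≤-trans (≤-reflexive (#at≡ l))
                            (≤-trans (⟦b⟧*x≤x (l <ᵇ L) (profile l)) (≤-reflexive (profile-tail M*3≤l)))

  #below≤1 : ∀ {l} → suc (M * 3) ≤ l → #below l ≤ 1
  #below≤1 {suc l} (s≤s M*3≤l) = #at≤1 M*3≤l

  #at-head : ∀ {j} → j ≤ M → ∀ {r} → r ≤ 4 → #at (r + j * 3) ≡ profile (r + j * 3)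
  #at-head {j} j≤M {r} r≤4 = #at-inside (begin-strict
    r + j * 3
      ≤⟨ +-mono-≤ r≤4 (*-monoˡ-≤ 3 j≤M) ⟩
    4 + M * 3
      <⟨ n<1+n (4 + M * 3) ⟩
    5 + M * 3
      ≡⟨ solve 1 (λ m → con 5 :+ m :* con 3 := (con 1 :+ m) :* con 3 :+ con 2) refl M ⟩
    P + 2
      ≤⟨ +-monoʳ-≤ P (m≤n+m 2 R′) ⟩
    L ∎)
    where open ≤-Reasoning

  term : ℕ → ℕ
  term l = profile l * (#at (suc l) * ∣ #below l - #at (suc (suc l)) ∣ ^ 2)

  term-flat : ∀ l → #below l ≡ #at (suc (suc l)) → term l ≡ 0
  term-flat l eq rewrite eq = term≡0 (profile l) (#at (suc l)) (#at (suc (suc l)))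

  term-small : ∀ l → profile l ≤ 1 → #at (suc l) ≤ 1 → ∣ #below l - #at (suc (suc l)) ∣ ≤ 1 → term l ≤ 1
  term-small l = term≤1 {profile l} {#at (suc l)} {#below l} {#at (suc (suc l))}

  block-terms≤2 : ∀ {j} → j ≤ M → term (j * 3) + term (suc (j * 3)) + term (suc (suc (j * 3))) ≤ 2
  block-terms≤2 {j} j≤M = +-mono-≤ (+-mono-≤ (first j j≤M) second) (≤-reflexive third)
    where
    link₁ : ∀ {i} → i ≤ M → #at (suc (i * 3)) ≡ 1
    link₁ {i} i≤M = trans (#at-head i≤M (s≤s z≤n)) (blockProfile-link₁ (tent M) i)
    link₂ : ∀ {i} → i ≤ M → #at (suc (suc (i * 3))) ≡ 1
    link₂ {i} i≤M = trans (#at-head i≤M (s≤s (s≤s z≤n))) (blockProfile-link₂ (tent M) i)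
    first : ∀ i → i ≤ M → term (i * 3) ≤ 1
    first zero    _    = term-small 0 ≤-refl (≤-reflexive (link₁ z≤n))
                                      (∣x-y∣≤1 (≤-trans (≤-reflexive #below-zero) z≤n) (≤-reflexive (link₂ z≤n)))
    first (suc i) i<M =
      ≤-trans (≤-reflexive (term-flat (suc i * 3) (trans (link₂ (<⇒≤ i<M)) (sym (link₂ i<M))))) z≤n
    second : term (suc (j * 3)) ≤ 1
    second = term-small (suc (j * 3)) (≤-reflexive (blockProfile-link₁ (tent M) j)) (≤-reflexive (link₂ j≤M))
      (subst₂ (λ a b → ∣ a - b ∣ ≤ 1)
        (sym (trans (#at-head j≤M z≤n) (blockProfile-head (tent M) j)))
        (sym (trans (#at-head j≤M (s≤s (s≤s (s≤s z≤n)))) (blockProfile-head (tent M) (suc j))))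
        (tent-step M j))
    third : term (suc (suc (j * 3))) ≡ 0
    third = term-flat (suc (suc (j * 3)))
              (trans (link₁ j≤M) (sym (trans (#at-head j≤M ≤-refl) (blockProfile-link₁ (tent M) (suc j)))))

  #at-tail : ∀ {l} → M * 3 ≤ l → l < L → #at l ≡ 1
  #at-tail M*3≤l l<L = trans (#at-inside l<L) (profile-tail M*3≤l)

  tail<L : ∀ {a k} → a ≤ 5 → k < R′ → a + (M * 3 + k) < L
  tail<L {a} {k} a≤5 k<R′ =
    subst₂ _<_ (solve 3 (λ m a k → m :+ (a :+ k) := a :+ (m :+ k)) refl (M * 3) a k)
               (solve 2 (λ m r → m :* con 3 :+ (con 5 :+ r) := (con 1 :+ m) :* con 3 :+ (r :+ con 2)) refl M R′)
               (+-monoʳ-< (M * 3) (+-mono-≤-< a≤5 k<R′))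

  head-terms≤ : ∑ℕ P term ≤ suc M * 2
  head-terms≤ = begin
    ∑ℕ P term
      ≡⟨ ∑ℕ-blocks (suc M) term ⟩
    ∑ℕ (suc M) (λ j → term (j * 3) + term (suc (j * 3)) + term (suc (suc (j * 3))))
      ≤⟨ ∑-mono (λ j → block-terms≤2 (≤-pred (Fin.toℕ<n j))) ⟩
    ∑[ j < suc M ] 2
      ≡⟨ ∑-const (suc M) 2 ⟩
    suc M * 2 ∎
    where open ≤-Reasoning

  tail-terms≤ : ∑ℕ (R′ + 2) (λ k → term (P + k)) ≤ 2
  tail-terms≤ = begin
    ∑ℕ (R′ + 2) (λ k → term (P + k))
      ≡⟨ ∑ℕ-+ R′ 2 (λ k → term (P + k)) ⟩
    ∑ℕ R′ (λ k → term (P + k)) + ∑ℕ 2 (λ k → term (P + (R′ + k)))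
      ≤⟨ +-mono-≤ (∑-mono (λ k → ≤-reflexive (flat (toℕ k) (Fin.toℕ<n k)))) (∑-mono {2} (λ k → last (toℕ k))) ⟩
    ∑[ k < R′ ] 0 + ∑[ k < 2 ] 1
      ≡⟨ cong (_+ 2) (∑-zero R′) ⟩
    2 ∎
    where
    open ≤-Reasoning
    flat : ∀ k → k < R′ → term (P + k) ≡ 0
    flat k k<R′ = term-flat (P + k) (trans (#at-tail (M*3≤a+[M*3+k] 2 k) (tail<L (s≤s (s≤s z≤n)) k<R′))
                                           (sym (#at-tail (M*3≤a+[M*3+k] 5 k) (tail<L ≤-refl k<R′))))
    last : ∀ k → term (P + (R′ + k)) ≤ 1
    last k = term-small (P + (R′ + k)) (≤-reflexive (profile-tail (M*3≤a+[M*3+k] 3 (R′ + k))))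
                                       (#at≤1 (M*3≤a+[M*3+k] 4 (R′ + k)))
                                       (∣x-y∣≤1 (#at≤1 (M*3≤a+[M*3+k] 2 (R′ + k))) (#at≤1 (M*3≤a+[M*3+k] 5 (R′ + k))))

  σ≤2[M+1]+2 : σ graph ≤ suc M * 2 + 2
  σ≤2[M+1]+2 = ≤-trans σ≤∑ℕ (≤-trans (≤-reflexive (∑ℕ-+ P (R′ + 2) term))
                                     (+-mono-≤ head-terms≤ tail-terms≤))

  high low : ℕ → Bool
  high l = suc K ≤ᵇ profile l
  low  l = P ≤ᵇ l

  suc-degree-high : ∀ u → T (high (lev u)) → suc K ≤ suc (degree graph u)
  suc-degree-high u high-u = begin
    suc K
      ≤⟨ ≤ᵇ⇒≤ (suc K) (profile (lev u)) high-u ⟩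
    profile (lev u)
      ≡⟨ #at-inside (lev<L u) ⟨
    #at (lev u)
      ≤⟨ ≤-trans (m≤n+m (#at (lev u)) (#below (lev u))) (m≤m+n _ _) ⟩
    #below (lev u) + #at (lev u) + #at (suc (lev u))
      ≡⟨ #near≡ (lev u) ⟨
    #near (lev u)
      ≡⟨ suc-degree≡#near u ⟨
    suc (degree graph u) ∎
    where open ≤-Reasoning

  suc-degree-low : ∀ u → T (low (lev u)) → suc (degree graph u) ≤ 3
  suc-degree-low u low-u = begin
    suc (degree graph u)
      ≡⟨ suc-degree≡#near u ⟩
    #near (lev u)
      ≡⟨ #near≡ (lev u) ⟩
    #below (lev u) + #at (lev u) + #at (suc (lev u))
      ≤⟨ +-mono-≤ (+-mono-≤ (#below≤1 M*3<l) (#at≤1 (<⇒≤ M*3<l))) (#at≤1 (m<n⇒m≤1+n M*3<l)) ⟩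
    3 ∎
    where
    open ≤-Reasoning
    M*3<l : M * 3 < lev u
    M*3<l = ≤-trans (s≤s (≤-trans (n≤1+n (M * 3)) (n≤1+n _))) (≤ᵇ⇒≤ P (lev u) low-u)

  degree-gap : ∀ u v → T (high (lev u)) → T (low (lev v)) → K ∸ 2 ≤ ∣ degree graph u - degree graph v ∣
  degree-gap u v high-u low-v = ≤-trans (∸-mono (suc-degree-high u high-u) (suc-degree-low v low-v))
                                        (m∸n≤∣m-n∣ (suc (degree graph u)) (suc (degree graph v)))

  #low≥ : R′ + 2 ≤ ∑[ u < order ] ⟦ low (lev u) ⟧
  #low≥ = begin
    R′ + 2
      ≡⟨ trans (∑-const (R′ + 2) 1) (*-identityʳ _) ⟨
    ∑[ k < R′ + 2 ] 1
      ≡⟨ sum-cong-≗ {R′ + 2} (λ k → sym (tail-low (toℕ k))) ⟩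
    ∑ℕ (R′ + 2) (λ k → F (P + k))
      ≤⟨ m≤n+m _ (∑ℕ P F) ⟩
    ∑ℕ P F + ∑ℕ (R′ + 2) (λ k → F (P + k))
      ≡⟨ ∑ℕ-+ P (R′ + 2) F ⟨
    ∑ℕ L F
      ≡⟨ ∑-by-level (λ l → ⟦ low l ⟧) ⟨
    ∑[ u < order ] ⟦ low (lev u) ⟧ ∎
    where
    open ≤-Reasoning
    F : ℕ → ℕ
    F l = profile l * ⟦ low l ⟧
    tail-low : ∀ k → F (P + k) ≡ 1
    tail-low k = cong₂ _*_ (profile-tail (M*3≤a+[M*3+k] 3 k)) (cong ⟦_⟧ (T⇒≡true (≤⇒≤ᵇ (m≤m+n P k))))

  #high≥ : suc K * suc K ≤ ∑[ u < order ] ⟦ high (lev u) ⟧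
  #high≥ = begin
    suc K * suc K
      ≡⟨ ∑-const (suc K) (suc K) ⟨
    ∑[ i < suc K ] suc K
      ≤⟨ ∑-mono (λ i → middle (toℕ i) (≤-pred (Fin.toℕ<n i))) ⟩
    ∑ℕ (suc K) (λ i → F ((K + i) * 3))
      ≤⟨ m≤m+n _ _ ⟩
    ∑ℕ (suc K) (λ i → F ((K + i) * 3)) + ∑ℕ K (λ i → F ((K + (suc K + i)) * 3))
      ≡⟨ ∑ℕ-+ (suc K) K (λ i → F ((K + i) * 3)) ⟨
    ∑ℕ (suc K + K) (λ i → F ((K + i) * 3))
      ≤⟨ m≤n+m _ (∑ℕ K (λ j → F (j * 3))) ⟩
    ∑ℕ K (λ j → F (j * 3)) + ∑ℕ (suc K + K) (λ i → F ((K + i) * 3))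
      ≡⟨ ∑ℕ-+ K (suc K + K) (λ j → F (j * 3)) ⟨
    ∑ℕ (K + (suc K + K)) (λ j → F (j * 3))
      ≡⟨ cong (λ b → ∑ℕ b (λ j → F (j * 3))) blocks ⟩
    ∑ℕ (suc M) (λ j → F (j * 3))
      ≤⟨ ∑-mono {suc M} (λ j → let x = toℕ j * 3 in ≤-trans (m≤m+n (F x) (F (suc x))) (m≤m+n _ (F (suc (suc x))))) ⟩
    ∑ℕ (suc M) (λ j → F (j * 3) + F (suc (j * 3)) + F (suc (suc (j * 3))))
      ≡⟨ ∑ℕ-blocks (suc M) F ⟨
    ∑ℕ P F
      ≤⟨ m≤m+n _ _ ⟩
    ∑ℕ P F + ∑ℕ (R′ + 2) (λ k → F (P + k))
      ≡⟨ ∑ℕ-+ P (R′ + 2) F ⟨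
    ∑ℕ L F
      ≡⟨ ∑-by-level (λ l → ⟦ high l ⟧) ⟨
    ∑[ u < order ] ⟦ high (lev u) ⟧ ∎
    where
    open ≤-Reasoning
    F : ℕ → ℕ
    F l = profile l * ⟦ high l ⟧
    blocks : K + (suc K + K) ≡ suc M
    blocks = solve 1 (λ k → k :+ ((con 1 :+ k) :+ k) := con 1 :+ con 3 :* k) refl K
    middle : ∀ i → i ≤ K → suc K ≤ F ((K + i) * 3)
    middle i i≤K rewrite blockProfile-head (tent M) (K + i)
                       | T⇒≡true (≤⇒≤ᵇ (s≤s (tent-middle K (K + i) (m≤m+n K i) (+-monoʳ-≤ K i≤K)))) =
      ≤-trans (s≤s (tent-middle K (K + i) (m≤m+n K i) (+-monoʳ-≤ K i≤K))) (≤-reflexive (sym (*-identityʳ _)))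

  [K+1]²[R′+2][K-2]²≤2σt : suc K * suc K * (R′ + 2) * (K ∸ 2) ^ 2 ≤ 2 * σt graph
  [K+1]²[R′+2][K-2]²≤2σt = ≤-trans (*-monoˡ-≤ ((K ∸ 2) ^ 2) (*-mono-≤ #high≥ #low≥))
                 (cross-gap≤2σt graph (high ∘ lev) (low ∘ lev) (K ∸ 2) degree-gap)

  connected-graph : Connected graph
  connected-graph = connected-profile (λ l _ → blockProfile≥1 (tent M) l)

  order≡head+tail : order ≡ ∑ℕ P profile + (R′ + 2)
  order≡head+tail = begin
    order
      ≡⟨ length-levels profile L ⟩
    ∑ℕ L profile
      ≡⟨ ∑ℕ-+ P (R′ + 2) profile ⟩
    ∑ℕ P profile + ∑ℕ (R′ + 2) (λ k → profile (P + k))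
      ≡⟨ cong (∑ℕ P profile +_) tail-size ⟩
    ∑ℕ P profile + (R′ + 2) * 1
      ≡⟨ cong (∑ℕ P profile +_) (*-identityʳ _) ⟩
    ∑ℕ P profile + (R′ + 2) ∎
    where
    open ≡-Reasoning
    tail-size : ∑ℕ (R′ + 2) (λ k → profile (P + k)) ≡ (R′ + 2) * 1
    tail-size = trans (sum-cong-≗ {R′ + 2} (λ k → profile-tail (M*3≤a+[M*3+k] 3 (toℕ k)))) (∑-const (R′ + 2) 1)

σt>0⇒σ>0 : ∀ {n} (G : SimpleGraph n) → Connected G → 0 < σt G → 0 < σ G
σt>0⇒σ>0 {n} G connected σt>0 with σ G | 2σt²≤3n⁵σ² n G connected
... | suc _ | _     = z<s
... | zero  | bound = ⊥-elim (<⇒≱ σt>0 (begin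
  σt G
    ≤⟨ m≤m² (σt G) ⟩
  σt G ^ 2
    ≤⟨ m≤m+n _ _ ⟩
  2 * σt G ^ 2
    ≤⟨ bound ⟩
  3 * n ^ 5 * 0 ^ 2
    ≡⟨ *-zeroʳ (3 * n ^ 5) ⟩
  0 ∎))
  where open ≤-Reasoning

bracket-square : ∀ c n → 1 ≤ c → ∃[ K ] c * K ^ 2 ≤ n × n < c * suc K ^ 2
bracket-square c zero    1≤c = 0 , ≤-reflexive (*-zeroʳ c) , subst (0 <_) (sym (*-identityʳ c)) 1≤c
bracket-square c (suc n) 1≤c with bracket-square c n 1≤c
... | K , lo , hi with suc (suc n) ≤? c * suc K ^ 2
...   | yes below = K , m≤n⇒m≤1+n lo , below
...   | no  ¬below = suc K , ≤-reflexive (sym n+1≡) , subst (_< c * suc (suc K) ^ 2) (sym n+1≡)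
                       (*-monoʳ-< c {{>-nonZero 1≤c}} (^-monoˡ-< 2 (n<1+n (suc K))))
  where
  n+1≡ : suc n ≡ c * suc K ^ 2
  n+1≡ = ≤-antisym hi (≮⇒≥ ¬below)

K≤2[K-2] : ∀ K → 4 ≤ K → K ≤ 2 * (K ∸ 2)
K≤2[K-2] (suc (suc K)) (s≤s (s≤s 2≤K)) = ≤-trans (+-monoˡ-≤ K 2≤K) (≤-reflexive (cong (K +_) (sym (+-identityʳ K))))

head+16K²≤64K² : ∀ K → 1 ≤ K → suc (3 * K) * 3 * suc (3 * K) + 16 * K ^ 2 ≤ 64 * K ^ 2
head+16K²≤64K² (suc k) _ = ≤-trans (m≤m+n _ (21 * k ^ 2 + 24 * k)) (≤-reflexive (solve 1 (λ k →
  (con 1 :+ con 3 :* (con 1 :+ k)) :* con 3 :* (con 1 :+ con 3 :* (con 1 :+ k)) :+ con 16 :* (con 1 :+ k) :^ 2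
    :+ (con 21 :* k :^ 2 :+ con 24 :* k) := con 64 :* (con 1 :+ k) :^ 2) refl k))

64[K+1]²≤256K² : ∀ K → 1 ≤ K → 64 * suc K ^ 2 ≤ 256 * K ^ 2
64[K+1]²≤256K² (suc k) _ = ≤-trans (m≤m+n _ (192 * k ^ 2 + 256 * k)) (≤-reflexive (solve 1 (λ k →
  con 64 :* (con 2 :+ k) :^ 2 :+ (con 192 :* k :^ 2 :+ con 256 :* k) := con 256 :* (con 1 :+ k) :^ 2) refl k))

2[3K+1]+2≤7K : ∀ K → 4 ≤ K → suc (3 * K) * 2 + 2 ≤ 7 * K
2[3K+1]+2≤7K (suc zero)             (s≤s ())
2[3K+1]+2≤7K (suc (suc zero))       (s≤s (s≤s ()))
2[3K+1]+2≤7K (suc (suc (suc zero))) (s≤s (s≤s (s≤s ())))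
2[3K+1]+2≤7K (suc (suc (suc (suc k)))) _ = ≤-trans (m≤m+n _ k) (≤-reflexive (solve 1 (λ k →
  (con 1 :+ con 3 :* (con 4 :+ k)) :* con 2 :+ con 2 :+ k := con 7 :* (con 4 :+ k)) refl k))

4K⁶≤[K+1]²R[K-2]² : ∀ K R → 4 ≤ K → 16 * K ^ 2 ≤ R → 2 * (2 * K ^ 6) ≤ suc K * suc K * R * (K ∸ 2) ^ 2
4K⁶≤[K+1]²R[K-2]² K R 4≤K 16K²≤R = begin
  2 * (2 * K ^ 6)
    ≡⟨ solve 1 (λ k → con 2 :* (con 2 :* k :^ 6) := con 4 :* (k :* k) :* (k :* k) :* (k :* k)) refl K ⟩
  4 * (K * K) * (K * K) * (K * K)
    ≤⟨ *-mono-≤ (*-monoˡ-≤ (K * K) (*-monoʳ-≤ 4 (*-mono-≤ (n≤1+n K) (n≤1+n K)))) (*-mono-≤ K≤2d K≤2d) ⟩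
  4 * (suc K * suc K) * (K * K) * ((2 * d) * (2 * d))
    ≡⟨ solve 3 (λ s k d → con 4 :* s :* (k :* k) :* ((con 2 :* d) :* (con 2 :* d))
        := s :* (con 16 :* k :^ 2) :* d :^ 2) refl (suc K * suc K) K d ⟩
  suc K * suc K * (16 * K ^ 2) * d ^ 2
    ≤⟨ *-monoˡ-≤ (d ^ 2) (*-monoʳ-≤ (suc K * suc K) 16K²≤R) ⟩
  suc K * suc K * R * d ^ 2 ∎
  where
  open ≤-Reasoning
  d : ℕ
  d = K ∸ 2
  K≤2d : K ≤ 2 * d
  K≤2d = K≤2[K-2] K 4≤K

n⁵s²≤49c⁵t² : ∀ {c n s t K} → n ≤ c * K ^ 2 → s ≤ 7 * K → K ^ 6 ≤ t → 1 * n ^ 5 * s ^ 2 ≤ 49 * c ^ 5 * t ^ 2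
n⁵s²≤49c⁵t² {c} {n} {s} {t} {K} n≤cK² s≤7K K⁶≤t = begin
  1 * n ^ 5 * s ^ 2
    ≤⟨ *-mono-≤ (*-monoʳ-≤ 1 (^-monoˡ-≤ 5 n≤cK²)) (^-monoˡ-≤ 2 s≤7K) ⟩
  1 * (c * K ^ 2) ^ 5 * (7 * K) ^ 2
    ≡⟨ solve 2 (λ c k → con 1 :* (c :* k :^ 2) :^ 5 :* (con 7 :* k) :^ 2
        := con 49 :* c :^ 5 :* (k :^ 6) :^ 2) refl c K ⟩
  49 * c ^ 5 * (K ^ 6) ^ 2
    ≤⟨ *-monoʳ-≤ (49 * c ^ 5) (^-monoˡ-≤ 2 K⁶≤t) ⟩
  49 * c ^ 5 * t ^ 2 ∎
  where open ≤-Reasoning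

LowerBoundWitness : ℕ → ℕ → Set
LowerBoundWitness q n = Σ (SimpleGraph n) (λ G → Connected G × 0 < σ G × 1 * n ^ 5 * σ G ^ 2 ≤ q * σt G ^ 2)

sharpness-witness : ∀ n K → 1024 ≤ n → 64 * K ^ 2 ≤ n → n < 64 * suc K ^ 2 → LowerBoundWitness (49 * 256 ^ 5) n
sharpness-witness n K 1024≤n 64K²≤n n<64[K+1]² =
  subst (LowerBoundWitness (49 * 256 ^ 5)) order≡n
        (graph , connected-graph , σt>0⇒σ>0 graph connected-graph σt>0 ,
         n⁵s²≤49c⁵t² {256} {order} {σ graph} {σt graph} {K} order≤ σ≤7K K⁶≤σt)
  where
  4≤K : 4 ≤ K
  4≤K with 4 ≤? K
  ... | yes 4≤K = 4≤K
  ... | no  4≰K = ⊥-elim (<⇒≱ n<64[K+1]² (≤-trans (*-monoʳ-≤ 64 (^-monoˡ-≤ 2 (≰⇒> 4≰K))) 1024≤n))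

  1≤K : 1 ≤ K
  1≤K = ≤-trans (s≤s z≤n) 4≤K

  module Head = TentProfile K
  base : ℕ
  base = ∑ℕ Head.P Head.profile

  base+16K²≤n : base + 16 * K ^ 2 ≤ n
  base+16K²≤n = ≤-trans (+-monoˡ-≤ (16 * K ^ 2) Head.head-size≤) (≤-trans (head+16K²≤64K² K 1≤K) 64K²≤n)

  16K²≤n-base : 16 * K ^ 2 ≤ n ∸ base
  16K²≤n-base = ≤-trans (≤-reflexive (sym (m+n∸m≡n base _))) (∸-monoˡ-≤ base base+16K²≤n)

  2≤n-base : 2 ≤ n ∸ base
  2≤n-base = ≤-trans (≤-trans (s≤s (s≤s z≤n)) (*-monoʳ-≤ 16 (^-monoˡ-≤ 2 1≤K))) 16K²≤n-base

  R′ : ℕ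
  R′ = n ∸ base ∸ 2
  open Construction K R′

  order≡n : order ≡ n
  order≡n = trans order≡head+tail
                  (trans (cong (base +_) (m∸n+n≡m 2≤n-base)) (m+[n∸m]≡n (≤-trans (m≤m+n base _) base+16K²≤n)))

  order≤ : order ≤ 256 * K ^ 2
  order≤ = ≤-trans (≤-reflexive order≡n) (≤-trans (<⇒≤ n<64[K+1]²) (64[K+1]²≤256K² K 1≤K))

  σ≤7K : σ graph ≤ 7 * K
  σ≤7K = ≤-trans σ≤2[M+1]+2 (2[3K+1]+2≤7K K 4≤K)

  K⁶≤σt : K ^ 6 ≤ σt graph
  K⁶≤σt = ≤-trans (m≤m+n (K ^ 6) _)
                  (*-cancelˡ-≤ 2 (≤-trans (4K⁶≤[K+1]²R[K-2]² K (R′ + 2) 4≤K R′+2≥) [K+1]²[R′+2][K-2]²≤2σt))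
    where
    R′+2≥ : 16 * K ^ 2 ≤ R′ + 2
    R′+2≥ = ≤-trans 16K²≤n-base (≤-reflexive (sym (m∸n+n≡m 2≤n-base)))

  σt>0 : 0 < σt graph
  σt>0 = ≤-trans (m^n>0 K {{>-nonZero 1≤K}} 6) K⁶≤σt

theorem3 : ((n : ℕ) (G : SimpleGraph n) → Connected G →
               2 * σt G ^ 2 ≤ 3 * n ^ 5 * σ G ^ 2)
             × Σ ℕ (λ p → Σ ℕ (λ q → Σ ℕ (λ N →
                 1 ≤ p × 1 ≤ q ×
                 ((n : ℕ) → N ≤ n →
                   Σ (SimpleGraph n) (λ G →
                     Connected G × 0 < σ G × p * n ^ 5 * σ G ^ 2 ≤ q * σt G ^ 2)))))
theorem3 = 2σt²≤3n⁵σ² , 1 , 49 * 256 ^ 5 , 1024 , ≤-refl , s≤s z≤n , λ n 1024≤n →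
  let K , 64K²≤n , n<64[K+1]² = bracket-square 64 n (s≤s z≤n) in sharpness-witness n K 1024≤n 64K²≤n n<64[K+1]²
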